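{- Let $G$ be a block graph (a connected graph all of whose blocks are cliques) of order $p$. Let $\omega = |V(C_D(G))|$ be the number of detour central vertices of $G$, let $\mathcal{L}(G)=\sum_{u\in V(G)}\mathcal{L}(u)$ be the total detour level of $G$, and let $\xi = \min\{|V(B)|-1 : B \text{ is a block of } G \text{ containing the detour central vertex}\}$ if $\omega = 1$, and $\xi = 0$ if $\omega \ge 2$. Then $$hc(G) \ge (p-1)(p-\omega) - 2\mathcal{L}(G) + \xi .$$
   Context: For vertices $u,v$ of a connected graph $G$, the detour distance $D(u,v)$ is the length of a longest $u$–$v$ path in $G$. The detour eccentricity of $v$ is $\max_{x\in V(G)} D(v,x)$; the detour center $C_D(G)$ is the subgraph induced by the vertices of minimum detour eccentricity (the detour central vertices). The detour level of a vertex $u$ is $\mathcal{L}(u)=\min\{D(w,u): w \text{ a detour central vertex}\}$. A hamiltonian coloring of a graph $G$ of order $p$ is a map $c:V(G)\to\{0,1,2,\dots\}$ such that $D(u,v)+|c(u)-c(v)|\ge p-1$ for every two distinct vertices $u,v$. Its value $hc(c)$ is the maximum color $\max_{v} c(v)$, and the hamiltonian chromatic number is $hc(G)=\min\{hc(c)\}$ over all hamiltonian colorings $c$ of $G$ (colors start at $0$, so this is one less than the convention where colors are positive integers). -}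

module Defs where

open import Data.Nat using (ℕ; zero; suc; _+_; _*_; _∸_; _≤_; _≤?_; _⊓_; _⊔_)
open import Data.Fin using (Fin; fromℕ; inject₁)
open import Data.Fin.Properties using (all?)
open import Data.Fin.Subset using (Subset; _∈_; _⊆_; ∣_∣)
open import Data.Vec using (tabulate)
open import Data.List using (List; []; _∷_; map; foldr; filter; allFin)
open import Data.Nat.ListAction using (sum)
open import Data.Product using (Σ; ∃; _×_; _,_)
open import Relation.Nullary using (¬_; does)
open import Relation.Binary.PropositionalEquality using (_≡_; _≢_)
open import Function.Definitions using (Injective)

record Graph (p : ℕ) : Set₁ where
  field
    Adj    : Fin p → Fin p → Set
    sym    : ∀ {x y} → Adj x y → Adj y x
    irrefl : ∀ {x} → ¬ Adj x x
open Graph public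

record Path {p : ℕ} (G : Graph p) (u v : Fin p) (ℓ : ℕ) : Set where
  field
    vert  : Fin (ℕ.suc ℓ) → Fin p
    inj   : Injective _≡_ _≡_ vert
    start : vert Data.Fin.zero ≡ u
    end   : vert (fromℕ ℓ) ≡ v
    step  : ∀ (i : Fin ℓ) → Adj G (vert (inject₁ i)) (vert (Data.Fin.suc i))
open Path public

ConnectedIn : ∀ {p} → Graph p → (Fin p → Set) → Set
ConnectedIn G P = ∀ u v → P u → P v →
  Σ ℕ λ ℓ → Σ (Path G u v ℓ) λ π → ∀ i → P (vert π i)

Connected : ∀ {p} → Graph p → Set
Connected G = ConnectedIn G (λ _ → Data.Unit.⊤)
  where import Data.Unit

Nonseparable : ∀ {p} → Graph p → Subset p → Set
Nonseparable G S =
  (∃ λ x → x ∈ S) ×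
  ConnectedIn G (λ x → x ∈ S) ×
  (∀ v → v ∈ S → ConnectedIn G (λ x → x ∈ S × x ≢ v))

-- A block: a maximal nonseparable subgraph (given by its vertex set; blocks are induced).
IsBlock : ∀ {p} → Graph p → Subset p → Set
IsBlock G S = Nonseparable G S × (∀ T → S ⊆ T → Nonseparable G T → T ⊆ S)

IsClique : ∀ {p} → Graph p → Subset p → Set
IsClique G S = ∀ x y → x ∈ S → y ∈ S → x ≢ y → Adj G x y

IsBlockGraph : ∀ {p} → Graph p → Set
IsBlockGraph G = Connected G × (∀ S → IsBlock G S → IsClique G S)

IsDetourDistance : ∀ {p} → Graph p → (Fin p → Fin p → ℕ) → Set
IsDetourDistance G D = ∀ u v → Path G u v (D u v) × (∀ ℓ → Path G u v ℓ → ℓ ≤ D u v)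

ecc : ∀ {p} → (Fin p → Fin p → ℕ) → Fin p → ℕ
ecc {p} D v = foldr _⊔_ 0 (map (D v) (allFin p))

isCentral : ∀ {p} → (Fin p → Fin p → ℕ) → Fin p → Set
isCentral D v = ∀ w → ecc D v ≤ ecc D w

centerSet : ∀ {p} → (Fin p → Fin p → ℕ) → Subset p
centerSet D = tabulate (λ v → does (all? (λ w → ecc D v ≤? ecc D w)))

centralList : ∀ {p} → (Fin p → Fin p → ℕ) → List (Fin p)
centralList {p} D = filter (λ v → all? (λ w → ecc D v ≤? ecc D w)) (allFin p)

omega : ∀ {p} → (Fin p → Fin p → ℕ) → ℕ
omega D = ∣ centerSet D ∣

-- minimum of a nonempty list (0 for the empty list; never used since the center is nonempty)
minList : List ℕ → ℕ
minList []       = 0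
minList (x ∷ xs) = foldr _⊓_ x xs

level : ∀ {p} → (Fin p → Fin p → ℕ) → Fin p → ℕ
level D u = minList (map (λ w → D w u) (centralList D))

totalLevel : ∀ {p} → (Fin p → Fin p → ℕ) → ℕ
totalLevel {p} D = sum (map (level D) (allFin p))

IsXi : ∀ {p} → Graph p → (Fin p → Fin p → ℕ) → ℕ → Set
IsXi G D ξ =
  (omega D ≡ 1 → ∀ z → isCentral D z →
     (∃ λ B → IsBlock G B × z ∈ B × ξ ≡ ∣ B ∣ ∸ 1) ×
     (∀ B → IsBlock G B → z ∈ B → ξ ≤ ∣ B ∣ ∸ 1)) ×
  (2 ≤ omega D → ξ ≡ 0)

IsHamiltonianColoring : ∀ {p} → (Fin p → Fin p → ℕ) → (Fin p → ℕ) → Set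
IsHamiltonianColoring {p} D c =
  ∀ u v → u ≢ v → p ∸ 1 ≤ D u v + Data.Nat.∣ c u - c v ∣

-- Order the vertices by color.  For consecutive vertices u, v the coloring condition gives
-- c v − c u ≥ (p − 1) − D(u, v), and D(u, v) ≤ L(u) + L(v) + (ω − 1): go from u to a nearest
-- central vertex, on to the central vertex nearest to v, and then to v.  Two central vertices
-- are at detour distance at most ω − 1 because in a block graph every vertex on a longest path
-- between central vertices is again central.  Summing over the p − 1 consecutive pairs, every
-- level is counted twice except those of the first and the last vertex, and these two levels add
-- up to at least ξ: if ω = 1, one of the two vertices u is not central, and a path from the
-- central vertex to u can be lengthened to run first through a whole block at the central vertex.

module Submission where

open import Defs hiding (sym)
open import Level using (0ℓ)
open import Data.Nat using (ℕ; zero; suc; _+_; _*_; _∸_; _≤_; _<_; z≤n; s≤s; _≤?_; _<?_; _⊔_; ∣_-_∣)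
open import Data.Nat.Properties
open import Data.Nat.Solver using (module +-*-Solver)
open import Data.Fin as F using (Fin; fromℕ; inject₁)
import Data.Fin.Properties as FP
open import Data.Fin.Subset as SS using (Subset; ∣_∣) renaming (_∈_ to _∈ˢ_; _⊆_ to _⊆ˢ_)
import Data.Fin.Subset.Properties as SP
open import Data.List as L using (List; []; _∷_; _++_; [_]; length; reverse; map)
open import Data.List.Properties
open import Data.List.Membership.Propositional using (_∈_; _∉_; lose)
open import Data.List.Membership.Propositional.Properties
open import Data.List.Relation.Unary.Any using (Any; here; there)
open import Data.List.Relation.Unary.Any.Properties using (reverse⁺; reverse⁻)
import Data.List.Relation.Unary.All as All
import Data.List.Relation.Unary.AllPairs as AllPairs
open import Data.List.Relation.Unary.Unique.Propositional using (Unique)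
import Data.List.Relation.Unary.Unique.Propositional.Properties as Unique
import Data.Nat.ListAction as LA
import Data.Nat.ListAction.Properties as LAP
import Data.Vec as Vec
import Data.Vec.Properties as VP
open import Data.Product using (Σ; ∃; _×_; _,_; proj₁; proj₂)
open import Data.Sum using (_⊎_; inj₁; inj₂; [_,_]′)
open import Data.Empty
open import Data.Unit using (tt)
open import Data.Bool using (true; false)
open import Relation.Nullary
open import Relation.Nullary.Negation using (DoubleNegation; ¬¬-Monad)
open import Relation.Nullary.Decidable using (¬¬-excluded-middle; decidable-stable; dec-true; _×-dec_; ¬?)
open import Data.List.Extrema.Nat using (argmin; f[argmin]≤f[xs]; argmax; argmax-sel; f[⊥]≤f[argmax]; f[xs]≤f[argmax])
open import Relation.Binary.Definitions using (tri<; tri≈; tri>)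
open import Relation.Binary.PropositionalEquality hiding ([_])
open import Effect.Monad using (RawMonad)
open import Function using (_∘_; id)
open import Function.Definitions using (Injective)

open RawMonad (¬¬-Monad {0ℓ}) using (pure; _>>=_)

infixr 5 _∷_

data Distinct {X : Set} : List X → Set where
  []  : Distinct []
  _∷_ : ∀ {x xs} → x ∉ xs → Distinct xs → Distinct (x ∷ xs)

module _ {X : Set} where

  distinct-head : ∀ {x : X} {xs} → Distinct (x ∷ xs) → x ∉ xs
  distinct-head (x∉ ∷ _) = x∉

  distinct-tail : ∀ {x : X} {xs} → Distinct (x ∷ xs) → Distinct xs
  distinct-tail (_ ∷ d) = d

  distinct-++ : ∀ {xs ys : List X} → Distinct xs → Distinct ys → (∀ {x} → x ∈ xs → x ∉ ys) → Distinct (xs ++ ys)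
  distinct-++ [] dys disj = dys
  distinct-++ (x∉ ∷ dxs) dys disj =
    (λ m → [ x∉ , disj (here refl) ]′ (∈-++⁻ _ m)) ∷ distinct-++ dxs dys (disj ∘ there)

  distinct-++ˡ : ∀ (xs : List X) {ys} → Distinct (xs ++ ys) → Distinct xs
  distinct-++ˡ [] d = []
  distinct-++ˡ (x ∷ xs) (x∉ ∷ d) = (λ m → x∉ (∈-++⁺ˡ m)) ∷ distinct-++ˡ xs d

  distinct-++ʳ : ∀ (xs : List X) {ys} → Distinct (xs ++ ys) → Distinct ys
  distinct-++ʳ [] d = d
  distinct-++ʳ (x ∷ xs) (_ ∷ d) = distinct-++ʳ xs d

  distinct-++-disjoint : ∀ (xs : List X) {ys} → Distinct (xs ++ ys) → ∀ {x} → x ∈ xs → x ∉ ys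
  distinct-++-disjoint (x ∷ xs) (x∉ ∷ d) (here refl) m = x∉ (∈-++⁺ʳ xs m)
  distinct-++-disjoint (x ∷ xs) (x∉ ∷ d) (there i) m = distinct-++-disjoint xs d i m

  distinct-∷ʳ : ∀ {xs : List X} {y} → Distinct xs → y ∉ xs → Distinct (xs L.∷ʳ y)
  distinct-∷ʳ d y∉ = distinct-++ d ((λ ()) ∷ []) (λ { m (here refl) → y∉ m })

  distinct-reverse : ∀ {xs : List X} → Distinct xs → Distinct (reverse xs)
  distinct-reverse [] = []
  distinct-reverse {x ∷ xs} (x∉ ∷ d) rewrite unfold-reverse x xs =
    distinct-∷ʳ (distinct-reverse d) (λ m → x∉ (reverse⁻ m))

  distinct-prefix : ∀ (xs : List X) {v ys} → Distinct (xs ++ v ∷ ys) → Distinct (xs ++ [ v ])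
  distinct-prefix xs d = distinct-∷ʳ (distinct-++ˡ xs d) (λ m → distinct-++-disjoint xs d m (here refl))

  distinct-remove : ∀ (xs : List X) {v ys} → Distinct (xs ++ v ∷ ys) → Distinct (xs ++ ys)
  distinct-remove xs d = distinct-++ (distinct-++ˡ xs d) (distinct-tail (distinct-++ʳ xs d))
    (λ m m' → distinct-++-disjoint xs d m (there m'))

  Unique⇒Distinct : ∀ {xs : List X} → Unique xs → Distinct xs
  Unique⇒Distinct AllPairs.[] = []
  Unique⇒Distinct (px AllPairs.∷ pxs) = (λ m → All.lookup px m refl) ∷ Unique⇒Distinct pxs

  distinct-length-≤ : ∀ {xs ys : List X} → Distinct xs → (∀ {x} → x ∈ xs → x ∈ ys) → length xs ≤ length ys
  distinct-length-≤ [] h = z≤n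
  distinct-length-≤ {x ∷ xs} {ys} (x∉ ∷ d) h with ∈-∃++ (h (here refl))
  ... | A , B , refl = subst (suc (length xs) ≤_) (sym (length-++-sucʳ A x B)) (s≤s (distinct-length-≤ d h'))
    where
      h' : ∀ {y} → y ∈ xs → y ∈ A ++ B
      h' {y} y∈ with ∈-++⁻ A (h (there y∈))
      ... | inj₁ y∈A = ∈-++⁺ˡ y∈A
      ... | inj₂ (here refl) = ⊥-elim (x∉ y∈)
      ... | inj₂ (there y∈B) = ∈-++⁺ʳ A y∈B

distinct-length≤∣p∣ : ∀ {m} {xs : List (Fin m)} {p : Subset m} →
  Distinct xs → (∀ {x} → x ∈ xs → x ∈ˢ p) → length xs ≤ ∣ p ∣
distinct-length≤∣p∣ [] h = z≤n
distinct-length≤∣p∣ {xs = x ∷ xs} {p} (x∉ ∷ d) h =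
  ≤-trans (s≤s (distinct-length≤∣p∣ {p = p SS.- x} d
                  (λ y∈ → SP.x∈p∧x≢y⇒x∈p-y (h (there y∈)) (λ { refl → x∉ y∈ }))))
          (SP.x∈p⇒∣p-x∣<∣p∣ (h (here refl)))

private
  predecessors : ∀ {m} → List (Fin (suc m)) → List (Fin m)
  predecessors [] = []
  predecessors (F.zero ∷ xs) = predecessors xs
  predecessors (F.suc x ∷ xs) = x ∷ predecessors xs

  suc∈⇒∈predecessors : ∀ {m} {x : Fin m} xs → F.suc x ∈ xs → x ∈ predecessors xs
  suc∈⇒∈predecessors (F.zero ∷ xs) (there m) = suc∈⇒∈predecessors xs m
  suc∈⇒∈predecessors (F.suc x ∷ xs) (here refl) = here refl
  suc∈⇒∈predecessors (F.suc y ∷ xs) (there m) = there (suc∈⇒∈predecessors xs m)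

  length-predecessors : ∀ {m} (xs : List (Fin (suc m))) → length (predecessors xs) ≤ length xs
  length-predecessors [] = z≤n
  length-predecessors (F.zero ∷ xs) = m≤n⇒m≤1+n (length-predecessors xs)
  length-predecessors (F.suc x ∷ xs) = s≤s (length-predecessors xs)

  length-predecessors-< : ∀ {m} (xs : List (Fin (suc m))) → F.zero ∈ xs → length (predecessors xs) < length xs
  length-predecessors-< (F.zero ∷ xs) _ = s≤s (length-predecessors xs)
  length-predecessors-< (F.suc x ∷ xs) (there m) = s≤s (length-predecessors-< xs m)

∣p∣≤length : ∀ {m} (p : Subset m) (xs : List (Fin m)) → (∀ x → x ∈ˢ p → x ∈ xs) → ∣ p ∣ ≤ length xs
∣p∣≤length Vec.[] xs h = z≤n
∣p∣≤length (false Vec.∷ p) xs h =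
  ≤-trans (∣p∣≤length p (predecessors xs) (λ x x∈ → suc∈⇒∈predecessors xs (h (F.suc x) (Vec.there x∈))))
          (length-predecessors xs)
∣p∣≤length (true Vec.∷ p) xs h =
  ≤-trans (s≤s (∣p∣≤length p (predecessors xs) (λ x x∈ → suc∈⇒∈predecessors xs (h (F.suc x) (Vec.there x∈)))))
          (length-predecessors-< xs (h F.zero Vec.here))

splitAtFirst : ∀ {X : Set} {P : X → Set} → (∀ x → Dec (P x)) → (zs : List X) → Any P zs →
  Σ (List X) λ as → Σ X λ x → Σ (List X) λ bs → zs ≡ as ++ x ∷ bs × P x × (∀ {y} → y ∈ as → ¬ P y)
splitAtFirst P? (z ∷ zs) a with P? z
... | yes pz = [] , z , zs , refl , pz , (λ ())
splitAtFirst P? (z ∷ zs) (here pz) | no ¬pz = ⊥-elim (¬pz pz)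
splitAtFirst P? (z ∷ zs) (there a) | no ¬pz with splitAtFirst P? zs a
... | as , x , bs , eq , px , ¬pas = z ∷ as , x , bs , cong (z ∷_) eq , px ,
       (λ { (here refl) → ¬pz ; (there m) → ¬pas m })

length-remove : ∀ {X : Set} (as : List X) {m bs} → length (as ++ m ∷ bs) ≡ suc (length (as ++ bs))
length-remove [] = refl
length-remove (a ∷ as) = cong suc (length-remove as)

∈-remove : ∀ {X : Set} (as : List X) {m bs y} → y ∈ as ++ bs → y ∈ as ++ m ∷ bs
∈-remove [] y∈ = there y∈
∈-remove (a ∷ as) (here eq) = here eq
∈-remove (a ∷ as) (there y∈) = there (∈-remove as y∈)

reverse-≡-++-∷ : ∀ {X : Set} (zs : List X) as t bs → reverse zs ≡ as ++ t ∷ bs → zs ≡ reverse bs ++ t ∷ reverse as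
reverse-≡-++-∷ zs as t bs eq = begin
    zs                                  ≡⟨ sym (reverse-involutive zs) ⟩
    reverse (reverse zs)                ≡⟨ cong reverse eq ⟩
    reverse (as ++ t ∷ bs)              ≡⟨ reverse-++ as (t ∷ bs) ⟩
    reverse (t ∷ bs) ++ reverse as      ≡⟨ cong (_++ reverse as) (unfold-reverse t bs) ⟩
    (reverse bs ++ [ t ]) ++ reverse as ≡⟨ ++-assoc (reverse bs) [ t ] (reverse as) ⟩
    reverse bs ++ t ∷ reverse as        ∎
  where open ≡-Reasoning

¬¬leastAbove : (Q : ℕ → Set) → ∀ j k → Q (j + k) →
  DoubleNegation (Σ ℕ λ h → j ≤ h × h ≤ j + k × Q h × (∀ m → j ≤ m → m < h → ¬ Q m))
¬¬leastAbove Q j zero q =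
  pure (j + zero , m≤m+n j 0 , ≤-refl , q , λ m j≤m m<h → ⊥-elim (<⇒≱ (subst (m <_) (+-identityʳ j) m<h) j≤m))
¬¬leastAbove Q j (suc k) q = do
  no ¬qj ← ¬¬-excluded-middle {A = Q j}
    where yes qj → pure (j , ≤-refl , m≤m+n j (suc k) , qj , λ m j≤m m<j → ⊥-elim (<⇒≱ m<j j≤m))
  h , 1+j≤h , h≤ , qh , minimal ← ¬¬leastAbove Q (suc j) k (subst Q (+-suc j k) q)
  pure (h , ≤-trans (n≤1+n j) 1+j≤h , ≤-trans h≤ (≤-reflexive (sym (+-suc j k))) , qh ,
        λ m j≤m m<h → [ (λ j<m → minimal m j<m m<h) , (λ { refl → ¬qj }) ]′ (m≤n⇒m<n∨m≡n j≤m))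

¬¬greatestBelow : (Q : ℕ → Set) → Q 0 → ∀ j →
  DoubleNegation (Σ ℕ λ h → h ≤ j × Q h × (∀ m → h < m → m ≤ j → ¬ Q m))
¬¬greatestBelow Q q0 zero = pure (0 , z≤n , q0 , λ m h<m m≤0 → ⊥-elim (<⇒≱ h<m m≤0))
¬¬greatestBelow Q q0 (suc j) = do
  no ¬qj ← ¬¬-excluded-middle {A = Q (suc j)}
    where yes qj → pure (suc j , ≤-refl , qj , λ m h<m m≤ → ⊥-elim (<⇒≱ h<m m≤))
  h , h≤j , qh , maximal ← ¬¬greatestBelow Q q0 j
  pure (h , m≤n⇒m≤1+n h≤j , qh ,
        λ m h<m m≤ → [ (λ m≤j → maximal m h<m (≤-pred m≤j)) , (λ { refl → ¬qj }) ]′ (m≤n⇒m<n∨m≡n m≤))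

-- Walks as vertex lists.  A path is a walk whose vertex list is distinct.

module Walks {p : ℕ} (G : Graph p) where

  V : Set
  V = Fin p

  open import Data.List.Membership.DecPropositional (FP._≟_ {p}) public using (_∈?_)

  infixr 5 _∷ʷ_

  data Walk : V → V → List V → Set where
    stop : ∀ u → Walk u u [ u ]
    _∷ʷ_ : ∀ {u w v ys} → Adj G u w → Walk w v ys → Walk u v (u ∷ ys)

  source∈ : ∀ {u v xs} → Walk u v xs → u ∈ xs
  source∈ (stop u) = here refl
  source∈ (e ∷ʷ π) = here refl

  target∈ : ∀ {u v xs} → Walk u v xs → v ∈ xs
  target∈ (stop u) = here refl
  target∈ (e ∷ʷ π) = there (target∈ π)

  walk-++ : ∀ {u a b v xs ys} → Walk u a xs → Adj G a b → Walk b v ys → Walk u v (xs ++ ys)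
  walk-++ (stop _) e ρ = e ∷ʷ ρ
  walk-++ (e' ∷ʷ π) e ρ = e' ∷ʷ walk-++ π e ρ

  walk-glue : ∀ {u x v} as {bs} → Walk u x (as ++ [ x ]) → Walk x v (x ∷ bs) → Walk u v (as ++ x ∷ bs)
  walk-glue [] (stop _) ρ = ρ
  walk-glue [] (e ∷ʷ ())
  walk-glue (a ∷ []) (e ∷ʷ π) ρ = e ∷ʷ walk-glue [] π ρ
  walk-glue (a ∷ b ∷ as) (e ∷ʷ π) ρ = e ∷ʷ walk-glue (b ∷ as) π ρ

  walk-upTo : ∀ {u v x} as {bs} → Walk u v (as ++ x ∷ bs) → Walk u x (as ++ [ x ])
  walk-upTo [] (stop _) = stop _
  walk-upTo [] (e ∷ʷ π) = stop _
  walk-upTo (a ∷ []) (e ∷ʷ π) = e ∷ʷ walk-upTo [] π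
  walk-upTo (a ∷ b ∷ as) (e ∷ʷ π) = e ∷ʷ walk-upTo (b ∷ as) π

  walk-from : ∀ {u v x} as {bs} → Walk u v (as ++ x ∷ bs) → Walk x v (x ∷ bs)
  walk-from [] (stop _) = stop _
  walk-from [] (e ∷ʷ π) = e ∷ʷ π
  walk-from (a ∷ []) (e ∷ʷ π) = walk-from [] π
  walk-from (a ∷ b ∷ as) (e ∷ʷ π) = walk-from (b ∷ as) π

  walk-reverse : ∀ {u v xs} → Walk u v xs → Walk v u (reverse xs)
  walk-reverse (stop u) = stop u
  walk-reverse {u} (_∷ʷ_ {ys = ys} e π) rewrite unfold-reverse u ys =
    walk-++ (walk-reverse π) (Graph.sym G e) (stop u)

  walk-reverse-∷ʳ : ∀ {u v} xs → Walk u v (xs ++ [ v ]) → Walk v u (v ∷ reverse xs)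
  walk-reverse-∷ʳ xs π = subst (Walk _ _) (reverse-++ xs [ _ ]) (walk-reverse π)

  walk-fromHead : ∀ {w b t d} → Walk w b (t ∷ d) → Walk t b (t ∷ d)
  walk-fromHead (stop _) = stop _
  walk-fromHead (e ∷ʷ π) = e ∷ʷ π

  ∃walk-dropLast : ∀ {a v z} cs → Walk a v (z ∷ cs ++ [ v ]) → Σ V λ s → Walk a s (z ∷ cs)
  ∃walk-dropLast [] (e ∷ʷ π) = _ , stop _
  ∃walk-dropLast (y ∷ cs) (e ∷ʷ π) = let (s , ρ) = ∃walk-dropLast cs π in s , e ∷ʷ ρ

  ∃++-last : ∀ {u v xs} → Walk u v xs → Σ (List V) λ as → xs ≡ as ++ [ v ]
  ∃++-last (stop u) = [] , refl
  ∃++-last (_∷ʷ_ {u = u} e π) = let (as , eq) = ∃++-last π in u ∷ as , cong (u ∷_) eq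

  -- Go around the closed walk from just after v to just before it.
  ∃walk-cycleDelete : ∀ {a b v} c d → Walk a b (c ++ v ∷ d) → Adj G b a → ¬ (c ≡ [] × d ≡ []) →
    Σ V λ s → Σ V λ t → Walk s t (d ++ c)
  ∃walk-cycleDelete [] [] π e nonTrivial = ⊥-elim (nonTrivial (refl , refl))
  ∃walk-cycleDelete [] (t ∷ d) (e' ∷ʷ π) e _ =
    t , _ , subst (Walk t _) (sym (++-identityʳ (t ∷ d))) (walk-fromHead π)
  ∃walk-cycleDelete {a} (z ∷ c) [] π e _ = a , ∃walk-dropLast c (walk-upTo (z ∷ c) π)
  ∃walk-cycleDelete (z ∷ c) (t ∷ d) π e _ with walk-from (z ∷ c) π
  ... | e' ∷ʷ π' = let (s , ρ) = ∃walk-dropLast c (walk-upTo (z ∷ c) π) in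
                     t , s , walk-++ (walk-fromHead π') e ρ

  walkLength : ∀ {u v xs} → Walk u v xs → ℕ
  walkLength (stop u) = 0
  walkLength (e ∷ʷ π) = suc (walkLength π)

  length-vertices : ∀ {u v xs} (π : Walk u v xs) → length xs ≡ suc (walkLength π)
  length-vertices (stop u) = refl
  length-vertices (e ∷ʷ π) = cong suc (length-vertices π)

  toPath : ∀ {u v xs} (π : Walk u v xs) → Distinct xs → Path G u v (walkLength π)
  toPath-vert∈ : ∀ {u v xs} (π : Walk u v xs) (d : Distinct xs) i → vert (toPath π d) i ∈ xs
  toPath (stop u) d = record
    { vert = λ _ → u ; inj = λ { {F.zero} {F.zero} _ → refl } ; start = refl ; end = refl ; step = λ () }
  toPath {u} (e ∷ʷ π) (u∉ ∷ d) = record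
    { vert = vt ; inj = vt-inj ; start = refl ; end = Path.end P ; step = vt-step }
    where
      P = toPath π d
      vt : Fin (suc (suc (walkLength π))) → V
      vt F.zero = u
      vt (F.suc i) = vert P i
      vt-inj : Injective _≡_ _≡_ vt
      vt-inj {F.zero} {F.zero} eq = refl
      vt-inj {F.zero} {F.suc j} eq = ⊥-elim (u∉ (subst (_∈ _) (sym eq) (toPath-vert∈ π d j)))
      vt-inj {F.suc i} {F.zero} eq = ⊥-elim (u∉ (subst (_∈ _) eq (toPath-vert∈ π d i)))
      vt-inj {F.suc i} {F.suc j} eq = cong F.suc (Path.inj P eq)
      vt-step : ∀ (i : Fin (suc (walkLength π))) → Adj G (vt (inject₁ i)) (vt (F.suc i))
      vt-step F.zero = subst (Adj G u) (sym (Path.start P)) e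
      vt-step (F.suc i) = Path.step P i
  toPath-vert∈ (stop u) d F.zero = here refl
  toPath-vert∈ (e ∷ʷ π) (_ ∷ d) F.zero = here refl
  toPath-vert∈ (e ∷ʷ π) (_ ∷ d) (F.suc i) = there (toPath-vert∈ π d i)

  private
    tabulate-walk : ∀ ℓ (f : Fin (suc ℓ) → V) → (∀ (i : Fin ℓ) → Adj G (f (inject₁ i)) (f (F.suc i))) →
                    Walk (f F.zero) (f (fromℕ ℓ)) (L.tabulate f)
    tabulate-walk zero f st = stop _
    tabulate-walk (suc ℓ) f st = st F.zero ∷ʷ tabulate-walk ℓ (f ∘ F.suc) (st ∘ F.suc)

  fromPath : ∀ {u v ℓ} → Path G u v ℓ → Σ (List V) λ xs → Walk u v xs × Distinct xs × length xs ≡ suc ℓ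
  fromPath {u} {v} {ℓ} π = L.tabulate (vert π) ,
    subst₂ (λ a b → Walk a b _) (Path.start π) (Path.end π) (tabulate-walk ℓ (vert π) (Path.step π)) ,
    Unique⇒Distinct (Unique.tabulate⁺ (Path.inj π)) , length-tabulate (vert π)

  toConnectedIn : ∀ {P : V → Set} {u v xs} → Walk u v xs → Distinct xs → (∀ {y} → y ∈ xs → P y) →
    Σ ℕ λ ℓ → Σ (Path G u v ℓ) λ π → ∀ i → P (vert π i)
  toConnectedIn π d h = walkLength π , toPath π d , λ i → h (toPath-vert∈ π d i)

  subpath-from : ∀ {u b zs v} → Walk u b zs → Distinct zs → v ∈ zs →
    Σ (List V) λ ys → Walk u v ys × Distinct ys × (∀ {y} → y ∈ ys → y ∈ zs)
  subpath-from {v = v} π d v∈ with ∈-∃++ v∈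
  ... | as , bs , refl = as ++ [ v ] , walk-upTo as π , distinct-prefix as d ,
        λ y∈ → [ ∈-++⁺ˡ , (λ { (here refl) → ∈-++⁺ʳ as (here refl) }) ]′ (∈-++⁻ as y∈)

  subpath : ∀ {a b xs u v} → Walk a b xs → Distinct xs → u ∈ xs → v ∈ xs →
    Σ (List V) λ ys → Walk u v ys × Distinct ys × (∀ {y} → y ∈ ys → y ∈ xs)
  subpath {xs = xs} {u} π d u∈ v∈ with ∈-∃++ u∈
  ... | as , bs , refl with ∈-++⁻ as v∈
  ... | inj₂ v∈bs = let (ys , ρ , dy , sub) = subpath-from (walk-from as π) (distinct-++ʳ as d) v∈bs
                    in ys , ρ , dy , ∈-++⁺ʳ as ∘ sub
  ... | inj₁ v∈as = let (ys , ρ , dy , sub) = subpath-from back dback (there (reverse⁺ v∈as))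
                    in ys , ρ , dy , toXs ∘ sub
    where
      back : Walk u _ (u ∷ reverse as)
      back = walk-reverse-∷ʳ as (walk-upTo as π)
      dback : Distinct (u ∷ reverse as)
      dback = (λ m → distinct-++-disjoint as d (reverse⁻ m) (here refl)) ∷ distinct-reverse (distinct-++ˡ as d)
      toXs : ∀ {y} → y ∈ u ∷ reverse as → y ∈ as ++ u ∷ bs
      toXs (here refl) = ∈-++⁺ʳ as (here refl)
      toXs (there m) = ∈-++⁺ˡ (reverse⁻ {xs = as} m)

  -- The vertices of a path as a sequence indexed by ℕ; positions beyond the end give the junk value u.
  vertexAt : ∀ {u v ℓ} → Path G u v ℓ → ℕ → V
  vertexAt {u} {ℓ = ℓ} π t with t <? suc ℓ
  ... | yes t<1+ℓ = vert π (F.fromℕ< t<1+ℓ)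
  ... | no _ = u

  private
    vertexAt≡vert : ∀ {u v ℓ} (π : Path G u v ℓ) t (t<1+ℓ : t < suc ℓ) → vertexAt π t ≡ vert π (F.fromℕ< t<1+ℓ)
    vertexAt≡vert {ℓ = ℓ} π t t<1+ℓ with t <? suc ℓ
    ... | yes _ = refl
    ... | no t≮1+ℓ = ⊥-elim (t≮1+ℓ t<1+ℓ)

  vertexAt-injective : ∀ {u v ℓ} (π : Path G u v ℓ) {i j} → i ≤ ℓ → j ≤ ℓ → vertexAt π i ≡ vertexAt π j → i ≡ j
  vertexAt-injective π {i} {j} i≤ℓ j≤ℓ eq = begin
    i                               ≡⟨ FP.toℕ-fromℕ< (s≤s i≤ℓ) ⟨
    F.toℕ (F.fromℕ< (s≤s i≤ℓ))      ≡⟨ cong F.toℕ (Path.inj π (trans (sym (vertexAt≡vert π i (s≤s i≤ℓ)))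
                                                          (trans eq (vertexAt≡vert π j (s≤s j≤ℓ))))) ⟩
    F.toℕ (F.fromℕ< (s≤s j≤ℓ))      ≡⟨ FP.toℕ-fromℕ< (s≤s j≤ℓ) ⟩
    j                               ∎
    where open ≡-Reasoning

  vertexAt-adjacent : ∀ {u v ℓ} (π : Path G u v ℓ) t → t < ℓ → Adj G (vertexAt π t) (vertexAt π (suc t))
  vertexAt-adjacent {ℓ = ℓ} π t t<ℓ =
    subst₂ (Adj G) (sym (trans (vertexAt≡vert π t (m≤n⇒m≤1+n t<ℓ)) (cong (vert π) here≡)))
                   (sym (trans (vertexAt≡vert π (suc t) (s≤s t<ℓ)) (cong (vert π) next≡)))
                   (Path.step π i)
    where
      i : Fin ℓ
      i = F.fromℕ< t<ℓ
      here≡ : F.fromℕ< (m≤n⇒m≤1+n t<ℓ) ≡ inject₁ i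
      here≡ = FP.toℕ-injective (trans (FP.toℕ-fromℕ< _) (sym (trans (FP.toℕ-inject₁ i) (FP.toℕ-fromℕ< t<ℓ))))
      next≡ : F.fromℕ< {suc t} {suc ℓ} (s≤s t<ℓ) ≡ F.suc i
      next≡ = FP.toℕ-injective (trans (FP.toℕ-fromℕ< {suc t} {suc ℓ} (s≤s t<ℓ)) (cong suc (sym (FP.toℕ-fromℕ< t<ℓ))))

  vertexAt-0 : ∀ {u v ℓ} (π : Path G u v ℓ) → vertexAt π 0 ≡ u
  vertexAt-0 π = trans (vertexAt≡vert π 0 (s≤s z≤n)) (Path.start π)

  vertexAt-ℓ : ∀ {u v ℓ} (π : Path G u v ℓ) → vertexAt π ℓ ≡ v
  vertexAt-ℓ {ℓ = ℓ} π = trans (vertexAt≡vert π ℓ ≤-refl)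
    (trans (cong (vert π) (FP.toℕ-injective (trans (FP.toℕ-fromℕ< _) (sym (FP.toℕ-fromℕ ℓ))))) (Path.end π))

  ¬¬cliqueWalk : ∀ z mids t → Distinct (z ∷ mids ++ [ t ]) →
    (∀ {x y} → x ∈ z ∷ mids ++ [ t ] → y ∈ z ∷ mids ++ [ t ] → x ≢ y → DoubleNegation (Adj G x y)) →
    DoubleNegation (Walk z t (z ∷ mids ++ [ t ]))
  ¬¬cliqueWalk z [] t (z∉ ∷ _) adj = do
    e ← adj (here refl) (there (here refl)) (λ { refl → z∉ (here refl) })
    pure (e ∷ʷ stop t)
  ¬¬cliqueWalk z (m ∷ mids) t (z∉ ∷ d) adj = do
    e ← adj (here refl) (there (here refl)) (λ { refl → z∉ (here refl) })
    π ← ¬¬cliqueWalk m mids t d (λ x∈ y∈ → adj (there x∈) (there y∈))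
    pure (e ∷ʷ π)

module Nonseparability {p : ℕ} (G : Graph p) where
  open Walks G

  toSubset : List V → Subset p
  toSubset = L.foldr (λ x s → SS.⁅ x ⁆ SS.∪ s) SS.⊥

  ∈⇒∈toSubset : ∀ {v xs} → v ∈ xs → v ∈ˢ toSubset xs
  ∈⇒∈toSubset {xs = x ∷ xs} (here refl) = SP.x∈p∪q⁺ (inj₁ (SP.x∈⁅x⁆ x))
  ∈⇒∈toSubset {xs = x ∷ xs} (there v∈) = SP.x∈p∪q⁺ (inj₂ (∈⇒∈toSubset v∈))

  ∈toSubset⇒∈ : ∀ {v} xs → v ∈ˢ toSubset xs → v ∈ xs
  ∈toSubset⇒∈ [] v∈ = ⊥-elim (SP.∉⊥ v∈)
  ∈toSubset⇒∈ (x ∷ xs) v∈ with SP.x∈p∪q⁻ SS.⁅ x ⁆ (toSubset xs) v∈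
  ... | inj₁ v∈⁅x⁆ = here (SP.x∈⁅y⁆⇒x≡y x v∈⁅x⁆)
  ... | inj₂ v∈xs = there (∈toSubset⇒∈ xs v∈xs)

  private
    cycle-delete : ∀ {a b xs v x} → Walk a b xs → Distinct xs → Adj G b a → v ∈ xs → x ∈ xs → x ≢ v →
      Σ (List V) λ W → Σ V λ s → Σ V λ t → Walk s t W × Distinct W ×
        (∀ {y} → y ∈ W → y ∈ xs × y ≢ v) × (∀ {y} → y ∈ xs → y ≢ v → y ∈ W)
    cycle-delete {v = v} {x} π d e v∈ x∈ x≢v with ∈-∃++ v∈
    ... | c , c' , refl =
      let (s , t , ρ) = ∃walk-cycleDelete c c' π e nonTrivial in c' ++ c , s , t , ρ , dW , fromW , toW
      where
        nonTrivial : ¬ (c ≡ [] × c' ≡ [])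
        nonTrivial (refl , refl) = x≢v (∈-[x]⇒≡ x∈)
          where ∈-[x]⇒≡ : ∀ {y z : V} → y ∈ [ z ] → y ≡ z
                ∈-[x]⇒≡ (here eq) = eq
        dW : Distinct (c' ++ c)
        dW = distinct-++ (distinct-tail (distinct-++ʳ c d)) (distinct-++ˡ c d)
               (λ y∈c' y∈c → distinct-++-disjoint c d y∈c (there y∈c'))
        fromW : ∀ {y} → y ∈ c' ++ c → y ∈ c ++ v ∷ c' × y ≢ v
        fromW y∈ with ∈-++⁻ c' y∈
        ... | inj₁ y∈c' = ∈-++⁺ʳ c (there y∈c') , λ { refl → distinct-head (distinct-++ʳ c d) y∈c' }
        ... | inj₂ y∈c = ∈-++⁺ˡ y∈c , λ { refl → distinct-++-disjoint c d y∈c (here refl) }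
        toW : ∀ {y} → y ∈ c ++ v ∷ c' → y ≢ v → y ∈ c' ++ c
        toW y∈ y≢v with ∈-++⁻ c y∈
        ... | inj₁ y∈c = ∈-++⁺ʳ c' y∈c
        ... | inj₂ (here refl) = ⊥-elim (y≢v refl)
        ... | inj₂ (there y∈c') = ∈-++⁺ˡ y∈c'

  cycle-nonseparable : ∀ {a b xs} → Walk a b xs → Distinct xs → Adj G b a → Nonseparable G (toSubset xs)
  cycle-nonseparable {a} {xs = xs} π d e = (a , ∈⇒∈toSubset (source∈ π)) , connected , noCutVertex
    where
      connected : ConnectedIn G (_∈ˢ toSubset xs)
      connected u v u∈ v∈ =
        let (ys , ρ , dys , sub) = subpath π d (∈toSubset⇒∈ xs u∈) (∈toSubset⇒∈ xs v∈)
        in toConnectedIn ρ dys (∈⇒∈toSubset ∘ sub)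
      noCutVertex : ∀ v → v ∈ˢ toSubset xs → ConnectedIn G (λ x → x ∈ˢ toSubset xs × x ≢ v)
      noCutVertex v v∈ x y (x∈ , x≢v) (y∈ , y≢v) =
        let (W , s , t , ρ , dW , fromW , toW) = cycle-delete π d e (∈toSubset⇒∈ xs v∈) (∈toSubset⇒∈ xs x∈) x≢v
            (ys , ρ' , dys , sub) = subpath ρ dW (toW (∈toSubset⇒∈ xs x∈) x≢v) (toW (∈toSubset⇒∈ xs y∈) y≢v)
        in toConnectedIn ρ' dys (λ y∈ys → let (z∈ , z≢v) = fromW (sub y∈ys) in ∈⇒∈toSubset z∈ , z≢v)

  Maximal : Subset p → Set
  Maximal S = ∀ T → S ⊆ˢ T → Nonseparable G T → T ⊆ˢ S

  -- By induction on the number of vertices outside S: a non-maximal S has a strictly larger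
  -- nonseparable superset.
  ¬¬block⊇ : ∀ S → Nonseparable G S → DoubleNegation (Σ (Subset p) λ B → IsBlock G B × S ⊆ˢ B)
  ¬¬block⊇ S = go (p ∸ ∣ S ∣) S ≤-refl
    where
      go : ∀ k S → p ∸ ∣ S ∣ ≤ k → Nonseparable G S → DoubleNegation (Σ (Subset p) λ B → IsBlock G B × S ⊆ˢ B)
      go k S bound nsS = do
        no ¬maximal ← ¬¬-excluded-middle {A = Maximal S}
          where yes maximal → pure (S , (nsS , maximal) , λ {_} x∈S → x∈S)
        T , S⊆T , nsT , x , x∈T , x∉S ← larger ¬maximal
        B , block , T⊆B ← continue k bound T (SP.p⊂q⇒∣p∣<∣q∣ (S⊆T , x , x∈T , x∉S)) nsT
        pure (B , block , λ {_} x∈S → T⊆B (S⊆T x∈S))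
        where
          larger : ¬ Maximal S →
            DoubleNegation (Σ (Subset p) λ T → S ⊆ˢ T × Nonseparable G T × Σ V λ x → x ∈ˢ T × ¬ x ∈ˢ S)
          larger ¬maximal ¬larger = ¬maximal λ T S⊆T nsT {x} x∈T →
            decidable-stable (x SP.∈? S) (λ x∉S → ¬larger (T , S⊆T , nsT , x , x∈T , x∉S))
          continue : ∀ k → p ∸ ∣ S ∣ ≤ k → ∀ T → ∣ S ∣ < ∣ T ∣ → Nonseparable G T →
            DoubleNegation (Σ (Subset p) λ B → IsBlock G B × T ⊆ˢ B)
          continue zero bound T S<T _ = ⊥-elim (<⇒≱ (<-≤-trans S<T (SP.∣p∣≤n T)) (m∸n≡0⇒m≤n (n≤0⇒n≡0 bound)))
          continue (suc k) bound T S<T nsT = go k T (≤-pred (≤-trans (∸-monoʳ-< S<T (SP.∣p∣≤n T)) bound)) nsT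

module Detour {p : ℕ} (G : Graph p) (connected : Connected G)
              (D : Fin p → Fin p → ℕ) (isD : IsDetourDistance G D) where
  open Walks G

  length≤1+D : ∀ {u v xs} → Walk u v xs → Distinct xs → length xs ≤ suc (D u v)
  length≤1+D {u} {v} π d = subst (_≤ suc (D u v)) (sym (length-vertices π)) (s≤s (proj₂ (isD u v) _ (toPath π d)))

  longestPath : ∀ u v → Σ (List V) λ xs → Walk u v xs × Distinct xs × length xs ≡ suc (D u v)
  longestPath u v = fromPath (proj₁ (isD u v))

  somePath : ∀ u v → Σ (List V) λ xs → Walk u v xs × Distinct xs
  somePath u v with connected u v tt tt
  ... | _ , π , _ with fromPath π
  ... | xs , ρ , d , _ = xs , ρ , d

  -- Follow a z–u path to the first vertex x on a longest u–v path; going from x either way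
  -- along that path gives a z–u and a z–v path which together cover it.
  D-triangle : ∀ z u v → D u v ≤ D z u + D z v
  D-triangle z u v with longestPath u v | somePath z u
  ... | rs , πr , dr , lr | zs , πz , dz
    with splitAtFirst (_∈? rs) zs (lose (target∈ πz) (source∈ πr))
  ... | as , x , bs , refl , x∈rs , ¬as∈rs with ∈-∃++ x∈rs
  ... | cs , ds , refl = begin
      D u v                   ≡⟨ suc-injective (trans (sym lr) (trans (length-++ cs) (+-suc (length cs) (length ds)))) ⟩
      length cs + length ds   ≤⟨ +-mono-≤ (part z→x→u (length-reverse cs) (distinct-++ (distinct-++ˡ as dz) dxu disj-xu))
                                          (part z→x→v refl (distinct-++ (distinct-++ˡ as dz) (distinct-++ʳ cs dr) disj-xv)) ⟩
      D z u + D z v           ∎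
    where
      open ≤-Reasoning
      z→x : Walk z x (as ++ [ x ])
      z→x = walk-upTo as πz
      z→x→u : Walk z u (as ++ x ∷ reverse cs)
      z→x→u = walk-glue as z→x (walk-reverse-∷ʳ cs (walk-upTo cs πr))
      z→x→v : Walk z v (as ++ x ∷ ds)
      z→x→v = walk-glue as z→x (walk-from cs πr)
      dxu : Distinct (x ∷ reverse cs)
      dxu = (λ m → distinct-++-disjoint cs dr (reverse⁻ m) (here refl)) ∷ distinct-reverse (distinct-++ˡ cs dr)
      disj-xu : ∀ {y} → y ∈ as → y ∉ x ∷ reverse cs
      disj-xu y∈as (here refl) = ¬as∈rs y∈as x∈rs
      disj-xu y∈as (there m) = ¬as∈rs y∈as (∈-++⁺ˡ (reverse⁻ {xs = cs} m))
      disj-xv : ∀ {y} → y ∈ as → y ∉ x ∷ ds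
      disj-xv y∈as m = ¬as∈rs y∈as (∈-++⁺ʳ cs m)
      part : ∀ {w ys} → Walk z w (as ++ x ∷ ys) → ∀ {k} → length ys ≡ k → Distinct (as ++ x ∷ ys) → k ≤ D z w
      part {w} {ys} π refl d = ≤-pred (≤-trans (s≤s (m≤n+m (length ys) (length as)))
        (subst (_≤ suc (D z w)) (trans (length-++ as) (+-suc (length as) (length ys))) (length≤1+D π d)))

  ++-length≤1+D : ∀ {a j y qs T} (P : V → Set) → Walk a j qs → Distinct qs → (∀ {z} → z ∈ qs → P z) →
    Walk j y (j ∷ T) → Distinct (j ∷ T) → (∀ {z} → z ∈ T → ¬ P z) → length qs + length T ≤ suc (D a y)
  ++-length≤1+D {a} {j} {y} {qs} {T} P a→j dqs qs⊆P j→y dT T∩P=∅ with ∃++-last a→j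
  ... | qs' , refl = subst (_≤ suc (D a y)) length≡ (length≤1+D (walk-glue qs' a→j j→y) dAll)
    where
      dAll : Distinct (qs' ++ j ∷ T)
      dAll = distinct-++ (distinct-++ˡ qs' dqs) dT
               λ { z∈ (here refl) → distinct-++-disjoint qs' dqs z∈ (here refl)
                 ; z∈ (there m) → T∩P=∅ m (qs⊆P (∈-++⁺ˡ z∈)) }
      length≡ : length (qs' ++ j ∷ T) ≡ length (qs' ++ [ j ]) + length T
      length≡ = trans (cong length (sym (++-assoc qs' [ j ] T))) (length-++ (qs' ++ [ j ]))

module Eccentricity {p : ℕ} (D : Fin p → Fin p → ℕ) where

  private
    V : Set
    V = Fin p

    foldr-⊔-lub : ∀ (f : V → ℕ) xs e → (∀ y → f y ≤ e) → L.foldr _⊔_ 0 (map f xs) ≤ e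
    foldr-⊔-lub f [] e h = z≤n
    foldr-⊔-lub f (x ∷ xs) e h = ⊔-lub (h x) (foldr-⊔-lub f xs e h)

    foldr-⊔-ub : ∀ (f : V → ℕ) {x} xs → x ∈ xs → f x ≤ L.foldr _⊔_ 0 (map f xs)
    foldr-⊔-ub f (x ∷ xs) (here refl) = m≤m⊔n _ _
    foldr-⊔-ub f (x ∷ xs) (there x∈) = ≤-trans (foldr-⊔-ub f xs x∈) (m≤n⊔m _ _)

  isCentral? : ∀ v → Dec (isCentral D v)
  isCentral? v = FP.all? (λ w → ecc D v ≤? ecc D w)

  ecc-lub : ∀ v e → (∀ y → D v y ≤ e) → ecc D v ≤ e
  ecc-lub v = foldr-⊔-lub (D v) (L.allFin p)

  D≤ecc : ∀ v y → D v y ≤ ecc D v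
  D≤ecc v y = foldr-⊔-ub (D v) (L.allFin p) (∈-allFin y)

  isCentral⇒∈centerSet : ∀ {v} → isCentral D v → v ∈ˢ centerSet D
  isCentral⇒∈centerSet {v} central =
    VP.lookup⇒[]= v _ (trans (VP.lookup∘tabulate (does ∘ isCentral?) v) (dec-true (isCentral? v) central))

  2≤omega : ∀ {u v} → u ≢ v → isCentral D u → isCentral D v → 2 ≤ omega D
  2≤omega {u} {v} u≢v cu cv = distinct-length≤∣p∣ {xs = u ∷ v ∷ []} ((λ { (here refl) → u≢v refl }) ∷ (λ ()) ∷ [])
    λ { (here refl) → isCentral⇒∈centerSet cu ; (there (here refl)) → isCentral⇒∈centerSet cv }

  ∈centralList⇒isCentral : ∀ {w} → w ∈ centralList D → isCentral D w
  ∈centralList⇒isCentral w∈ = proj₂ (∈-filter⁻ isCentral? {xs = L.allFin p} w∈)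

module Levels {n : ℕ} (D : Fin (suc n) → Fin (suc n) → ℕ) where
  open Eccentricity D

  private
    V : Set
    V = Fin (suc n)

  ∃central : Σ V (isCentral D)
  ∃central = argmin (ecc D) F.zero (L.allFin (suc n)) ,
              λ w → All.lookup (f[argmin]≤f[xs] {f = ecc D} F.zero (L.allFin (suc n))) (∈-allFin w)

  1≤omega : 1 ≤ omega D
  1≤omega = distinct-length≤∣p∣ {xs = [ proj₁ ∃central ]} ((λ ()) ∷ [])
              λ { (here refl) → isCentral⇒∈centerSet (proj₂ ∃central) }

  level-attained : ∀ u → Σ V λ w → isCentral D w × level D u ≡ D w u
  level-attained u with centralList D in eq
  ... | [] = ⊥-elim (¬∈[] (subst (proj₁ ∃central ∈_) eq (∈-filter⁺ isCentral? (∈-allFin _) (proj₂ ∃central))))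
    where ¬∈[] : ∀ {x : V} → x ∉ []
          ¬∈[] ()
  ... | w ∷ ws with foldr-selective ⊓-sel (D w u) (map (λ w' → D w' u) ws)
  ...   | inj₁ level≡ = w , ∈centralList⇒isCentral (subst (w ∈_) (sym eq) (here refl)) , level≡
  ...   | inj₂ level∈ with ∈-map⁻ (λ w' → D w' u) level∈
  ...     | w' , w'∈ , level≡ = w' , ∈centralList⇒isCentral (subst (w' ∈_) (sym eq) (there w'∈)) , level≡

module BlockGraph {p : ℕ} (G : Graph p) (blockGraph : IsBlockGraph G)
                  (D : Fin p → Fin p → ℕ) (isD : IsDetourDistance G D) where
  open Walks G
  open Nonseparability G
  open Detour G (proj₁ blockGraph) D isD

  ¬¬cycle-clique : ∀ {a b xs} → Walk a b xs → Distinct xs → Adj G b a →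
    ∀ {x y} → x ∈ xs → y ∈ xs → x ≢ y → DoubleNegation (Adj G x y)
  ¬¬cycle-clique {xs = xs} π d e x∈ y∈ x≢y = do
    B , block , xs⊆B ← ¬¬block⊇ (toSubset xs) (cycle-nonseparable π d e)
    pure (proj₂ blockGraph B block _ _ (xs⊆B (∈⇒∈toSubset x∈)) (xs⊆B (∈⇒∈toSubset y∈)) x≢y)

  -- Run from w through all other vertices of the clique B to t, then along the path to u.
  ∣B∣∸1≤D : ∀ {B w t u T} → IsBlock G B → w ∈ˢ B → t ∈ˢ B → w ≢ t →
    Walk t u (t ∷ T) → Distinct (t ∷ T) → (∀ {y} → y ∈ T → ¬ y ∈ˢ B) → ∣ B ∣ ∸ 1 ≤ D w u
  ∣B∣∸1≤D {B} {w} {t} {u} {T} block w∈B t∈B w≢t t→u dT T∩B=∅ = decidable-stable (_ ≤? _) do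
    w→t ← ¬¬cliqueWalk w inner t dClique (λ x∈ y∈ x≢y → pure (proj₂ blockGraph B block _ _ (∈B x∈) (∈B y∈) x≢y))
    pure (begin
      ∣ B ∣ ∸ 1                        ≤⟨ ∸-monoˡ-≤ 1 (∣p∣≤length B (w ∷ t ∷ inner) B⊆) ⟩
      suc (length inner)               ≤⟨ m≤m+n _ (length T) ⟩
      suc (length inner) + length T    ≡⟨ trans (length-++ inner) (+-suc (length inner) (length T)) ⟨
      length (inner ++ t ∷ T)          ≤⟨ ≤-pred (length≤1+D (walk-glue (w ∷ inner) w→t t→u) dW) ⟩
      D w u                            ∎)
    where
      open ≤-Reasoning
      Inner : V → Set
      Inner v = v ∈ˢ B × v ≢ w × v ≢ t
      Inner? : ∀ v → Dec (Inner v)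
      Inner? v = (v SP.∈? B) ×-dec ¬? (v FP.≟ w) ×-dec ¬? (v FP.≟ t)
      inner : List V
      inner = L.filter Inner? (L.allFin p)
      inner⁻ : ∀ {v} → v ∈ inner → Inner v
      inner⁻ v∈ = proj₂ (∈-filter⁻ Inner? {xs = L.allFin p} v∈)
      dInner : Distinct inner
      dInner = Unique⇒Distinct (Unique.filter⁺ Inner? (Unique.allFin⁺ p))
      B⊆ : ∀ v → v ∈ˢ B → v ∈ w ∷ t ∷ inner
      B⊆ v v∈B with v FP.≟ w | v FP.≟ t
      ... | yes refl | _ = here refl
      ... | no _ | yes refl = there (here refl)
      ... | no v≢w | no v≢t = there (there (∈-filter⁺ Inner? (∈-allFin v) (v∈B , v≢w , v≢t)))
      dClique : Distinct (w ∷ inner ++ [ t ])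
      dClique = (λ m → [ (λ m' → proj₁ (proj₂ (inner⁻ m')) refl) , (λ { (here refl) → w≢t refl }) ]′ (∈-++⁻ inner m))
                ∷ distinct-∷ʳ dInner (λ m → proj₂ (proj₂ (inner⁻ m)) refl)
      ∈B : ∀ {x} → x ∈ w ∷ inner ++ [ t ] → x ∈ˢ B
      ∈B (here refl) = w∈B
      ∈B (there m) with ∈-++⁻ inner m
      ... | inj₁ m' = proj₁ (inner⁻ m')
      ... | inj₂ (here refl) = t∈B
      dW : Distinct ((w ∷ inner) ++ t ∷ T)
      dW = distinct-++ ((λ m → proj₁ (proj₂ (inner⁻ m)) refl) ∷ dInner) dT
             λ { (here refl) (here refl) → w≢t refl ; (here refl) (there m) → T∩B=∅ m w∈B
               ; (there m) (here refl) → proj₂ (proj₂ (inner⁻ m)) refl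
               ; (there m) (there m') → T∩B=∅ m' (proj₁ (inner⁻ m)) }

  -- Take a block containing the first edge w s of a w–u path and the last vertex t of the path in it.
  ¬¬∃block-∣B∣∸1≤D : ∀ w u → w ≢ u →
    DoubleNegation (Σ (Subset p) λ B → IsBlock G B × w ∈ˢ B × ∣ B ∣ ∸ 1 ≤ D w u)
  ¬¬∃block-∣B∣∸1≤D w u w≢u with somePath w u
  ... | _ , stop _ , _ = ⊥-elim (w≢u refl)
  ... | _ , _∷ʷ_ {w = s} {ys = ys} e π , w∉ys ∷ dys = do
    B , block , ws⊆B ← ¬¬block⊇ (toSubset (w ∷ s ∷ [])) (cycle-nonseparable (e ∷ʷ stop s) dws (Graph.sym G e))
    let w∈B = ws⊆B (∈⇒∈toSubset {xs = w ∷ s ∷ []} (here refl))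
        s∈B = ws⊆B (∈⇒∈toSubset {xs = w ∷ s ∷ []} (there (here refl)))
        as , t , bs , eq , t∈B , ¬as∈B = splitAtFirst (λ x → x SP.∈? B) (reverse ys) (lose (reverse⁺ (source∈ π)) s∈B)
        ys≡ = reverse-≡-++-∷ ys as t bs eq
        dys' = subst Distinct ys≡ dys
        t∈ys = subst (t ∈_) (sym ys≡) (∈-++⁺ʳ (reverse bs) (here refl))
    pure (B , block , w∈B ,
          ∣B∣∸1≤D block w∈B t∈B (λ w≡t → w∉ys (subst (_∈ ys) (sym w≡t) t∈ys))
                  (walk-from (reverse bs) (subst (Walk s u) ys≡ π)) (distinct-++ʳ (reverse bs) dys')
                  (λ m → ¬as∈B (reverse⁻ m)))
    where
      dws : Distinct (w ∷ s ∷ [])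
      dws = (λ { (here refl) → irrefl G e }) ∷ (λ ()) ∷ []
  module AlongPath (ℓ : ℕ) (g : ℕ → V)
                   (g-injective : ∀ {i j} → i ≤ ℓ → j ≤ ℓ → g i ≡ g j → i ≡ j)
                   (g-adjacent : ∀ t → t < ℓ → Adj G (g t) (g (suc t))) where

    g-≢ : ∀ {i j} → i ≤ ℓ → j ≤ ℓ → i ≢ j → g i ≢ g j
    g-≢ i≤ℓ j≤ℓ i≢j eq = i≢j (g-injective i≤ℓ j≤ℓ eq)

    segment : ℕ → ℕ → List V
    segment c zero = []
    segment c (suc k) = g c ∷ segment (suc c) k

    length-segment : ∀ c k → length (segment c k) ≡ k
    length-segment c zero = refl
    length-segment c (suc k) = cong suc (length-segment (suc c) k)

    ∈segment⁻ : ∀ c k {x} → x ∈ segment c k → Σ ℕ λ t → c ≤ t × t < c + k × x ≡ g t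
    ∈segment⁻ c (suc k) (here refl) = c , ≤-refl , m<m+n c (s≤s z≤n) , refl
    ∈segment⁻ c (suc k) (there x∈) with ∈segment⁻ (suc c) k x∈
    ... | t , c<t , t< , x≡ = t , <⇒≤ c<t , subst (t <_) (sym (+-suc c k)) t< , x≡

    ∈segment⁺ : ∀ c k t → c ≤ t → t < c + k → g t ∈ segment c k
    ∈segment⁺ c zero t c≤t t< = ⊥-elim (<⇒≱ (subst (t <_) (+-identityʳ c) t<) c≤t)
    ∈segment⁺ c (suc k) t c≤t t< with m≤n⇒m<n∨m≡n c≤t
    ... | inj₂ refl = here refl
    ... | inj₁ c<t = there (∈segment⁺ (suc c) k t c<t (subst (t <_) (+-suc c k) t<))

    g∉segment : ∀ t c k → t ≤ ℓ → c + k ≤ suc ℓ → t < c ⊎ c + k ≤ t → g t ∉ segment c k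
    g∉segment t c k t≤ℓ c+k≤ outside g∈ with ∈segment⁻ c k g∈
    ... | t' , c≤t' , t'< , eq with g-injective t≤ℓ (≤-pred (≤-trans t'< c+k≤)) eq
    ... | refl = [ (λ t<c → <⇒≱ t<c c≤t') , (λ c+k≤t → <⇒≱ t'< c+k≤t) ]′ outside

    distinct-segment : ∀ c k → c + k ≤ suc ℓ → Distinct (segment c k)
    distinct-segment c zero _ = []
    distinct-segment c (suc k) c+k≤ =
      g∉segment c (suc c) k (≤-pred (≤-trans (s≤s (m≤m+n c k)) c+k≤′)) c+k≤′ (inj₁ ≤-refl)
      ∷ distinct-segment (suc c) k c+k≤′
      where c+k≤′ : suc c + k ≤ suc ℓ
            c+k≤′ = subst (_≤ suc ℓ) (+-suc c k) c+k≤

    segment-walk : ∀ c k → c + k ≤ ℓ → Walk (g c) (g (c + k)) (segment c (suc k))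
    segment-walk c zero _ = subst (λ z → Walk (g c) (g z) [ g c ]) (sym (+-identityʳ c)) (stop (g c))
    segment-walk c (suc k) c+k≤ℓ =
      g-adjacent c (≤-trans (m<m+n c (s≤s z≤n)) c+k≤ℓ) ∷ʷ
      subst (λ z → Walk (g (suc c)) (g z) (segment (suc c) (suc k))) (sym (+-suc c k))
            (segment-walk (suc c) k (subst (_≤ ℓ) (+-suc c k) c+k≤ℓ))

    segment-∷ʳ : ∀ c k → segment c (suc k) ≡ segment c k ++ [ g (c + k) ]
    segment-∷ʳ c zero = cong (λ z → [ g z ]) (sym (+-identityʳ c))
    segment-∷ʳ c (suc k) = cong (g c ∷_)
      (trans (segment-∷ʳ (suc c) k) (cong (λ z → segment (suc c) k ++ [ g z ]) (sym (+-suc c k))))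

    OnP : V → Set
    OnP x = x ∈ segment 0 (suc ℓ)

    OnP? : ∀ x → Dec (OnP x)
    OnP? x = x ∈? segment 0 (suc ℓ)

    AllOnP : List V → Set
    AllOnP ys = ∀ {z} → z ∈ ys → OnP z

    onP⁻ : ∀ {x} → OnP x → Σ ℕ λ t → t ≤ ℓ × x ≡ g t
    onP⁻ x∈ with ∈segment⁻ 0 (suc ℓ) x∈
    ... | t , _ , t<1+ℓ , x≡ = t , ≤-pred t<1+ℓ , x≡

    onP⁺ : ∀ t → t ≤ ℓ → OnP (g t)
    onP⁺ t t≤ℓ = ∈segment⁺ 0 (suc ℓ) t z≤n (s≤s t≤ℓ)

    onP-segment : ∀ c k → c + k ≤ suc ℓ → AllOnP (segment c k)
    onP-segment c k c+k≤ x∈ with ∈segment⁻ c k x∈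
    ... | t , _ , t< , refl = onP⁺ t (≤-pred (≤-trans t< c+k≤))

    -- g m is a cut vertex of the path: no edge of G jumps over it.
    IsCut : ℕ → Set
    IsCut m = ∀ c a → c < m → m < a → a ≤ ℓ → ¬ Adj G (g c) (g a)

    isCut-0 : IsCut 0
    isCut-0 c a ()

    isCut-ℓ : IsCut ℓ
    isCut-ℓ c a _ ℓ<a a≤ℓ _ = <⇒≱ ℓ<a a≤ℓ

    ¬¬chordAcross : ∀ {m} → ¬ IsCut m →
      DoubleNegation (Σ ℕ λ c → Σ ℕ λ a → c < m × m < a × a ≤ ℓ × Adj G (g c) (g a))
    ¬¬chordAcross ¬cut ¬chord = ¬cut λ c a c<m m<a a≤ℓ e → ¬chord (c , a , c<m , m<a , a≤ℓ , e)

    private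
      adj-g : ∀ {x w tx tw} → x ≡ g tx → w ≡ g tw → Adj G x w → Adj G (g tw) (g tx)
      adj-g refl refl e = Graph.sym G e

    walk-down-through-cut : ∀ m → IsCut m → ∀ {x y ys} → Walk x y ys → AllOnP ys → ∀ tx ty → tx ≤ ℓ → ty ≤ ℓ →
      x ≡ g tx → y ≡ g ty → m < tx → ty ≤ m → g m ∈ ys
    walk-down-through-cut m cut (stop u) _ tx ty tx≤ℓ ty≤ℓ refl y≡ m<tx ty≤m =
      ⊥-elim (<⇒≱ m<tx (≤-trans (≤-reflexive (g-injective tx≤ℓ ty≤ℓ y≡)) ty≤m))
    walk-down-through-cut m cut (e ∷ʷ π) onP tx ty tx≤ℓ ty≤ℓ x≡ y≡ m<tx ty≤m with onP⁻ (onP (there (source∈ π)))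
    ... | tw , tw≤ℓ , w≡ with <-cmp tw m
    ... | tri< tw<m _ _ = ⊥-elim (cut tw tx tw<m m<tx tx≤ℓ (adj-g x≡ w≡ e))
    ... | tri≈ _ refl _ = there (subst (_∈ _) w≡ (source∈ π))
    ... | tri> _ _ m<tw = there (walk-down-through-cut m cut π (onP ∘ there) tw ty tw≤ℓ ty≤ℓ w≡ y≡ m<tw ty≤m)

    walk-up-through-cut : ∀ m → IsCut m → ∀ {x y ys} → Walk x y ys → AllOnP ys → ∀ tx → tx ≤ ℓ → x ≡ g tx → tx ≤ m →
      ∀ {z} → z ∈ ys → ∀ tz → tz ≤ ℓ → z ≡ g tz → m < tz →
      Σ (List V) λ X → Σ (List V) λ Y → ys ≡ X ++ g m ∷ Y × Σ ℕ λ tz' → g tz' ∈ Y × tz' ≤ ℓ × m < tz'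
    walk-up-through-cut m cut (stop u) _ tx tx≤ℓ x≡ tx≤m (here refl) tz tz≤ℓ z≡ m<tz =
      ⊥-elim (<⇒≱ m<tz (≤-trans (≤-reflexive (g-injective tz≤ℓ tx≤ℓ (trans (sym z≡) x≡))) tx≤m))
    walk-up-through-cut m cut (e ∷ʷ π) _ tx tx≤ℓ x≡ tx≤m (here refl) tz tz≤ℓ z≡ m<tz =
      ⊥-elim (<⇒≱ m<tz (≤-trans (≤-reflexive (g-injective tz≤ℓ tx≤ℓ (trans (sym z≡) x≡))) tx≤m))
    walk-up-through-cut m cut (_∷ʷ_ {u = x} {ys = ys} e π) onP tx tx≤ℓ x≡ tx≤m (there z∈) tz tz≤ℓ z≡ m<tz
      with onP⁻ (onP (there (source∈ π)))
    ... | tw , tw≤ℓ , w≡ with m <? tw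
    ... | yes m<tw = [ (λ tx<m → ⊥-elim (cut tx tw tx<m m<tw tw≤ℓ (Graph.sym G (adj-g x≡ w≡ e))))
                     , (λ { refl → [] , ys , cong (_∷ ys) x≡ , tw , subst (_∈ ys) w≡ (source∈ π) , tw≤ℓ , m<tw })
                     ]′ (m≤n⇒m<n∨m≡n tx≤m)
    ... | no m≮tw with walk-up-through-cut m cut π (onP ∘ there) tw tw≤ℓ w≡ (≮⇒≥ m≮tw) z∈ tz tz≤ℓ z≡ m<tz
    ... | X , Y , ys≡ , rest = x ∷ X , Y , cong (x ∷_) ys≡ , rest

    -- A path on g between vertices of index at most m, for a cut m, stays at index at most m:
    -- otherwise it would pass g m on the way up and again on the way down.
    path-below-cut : ∀ m → IsCut m → ∀ {x y rs} → Walk x y rs → Distinct rs → AllOnP rs → ∀ i j → i ≤ ℓ → j ≤ ℓ →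
      x ≡ g i → y ≡ g j → i ≤ m → j ≤ m → ∀ {z} → z ∈ rs → ∀ t → t ≤ ℓ → z ≡ g t → t ≤ m
    path-below-cut m cut {y = y} π drs onP i j i≤ℓ j≤ℓ x≡ y≡ i≤m j≤m z∈ t t≤ℓ z≡ with t ≤? m
    ... | yes t≤m = t≤m
    ... | no t≰m with walk-up-through-cut m cut π onP i i≤ℓ x≡ i≤m z∈ t t≤ℓ z≡ (≰⇒> t≰m)
    ... | X , Y , refl , tz' , z'∈Y , tz'≤ℓ , m<tz' with ∈-∃++ z'∈Y
    ... | Y₁ , Y₂ , refl =
      ⊥-elim (distinct-head (distinct-++ʳ X drs)
        (∈-++⁺ʳ Y₁ (walk-down-through-cut m cut (walk-from (g m ∷ Y₁) (walk-from X π))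
                      (λ z∈ → onP (∈-++⁺ʳ X (there (∈-++⁺ʳ Y₁ z∈)))) tz' j tz'≤ℓ j≤ℓ refl y≡ m<tz' j≤m)))

    -- A chord g c ~ g a closes the cycle g c, …, g a, which lies in a block and hence in a clique.
    ¬¬chord-clique : ∀ c a → c < a → a ≤ ℓ → Adj G (g c) (g a) →
      ∀ x y → c ≤ x → x ≤ a → c ≤ y → y ≤ a → x ≢ y → DoubleNegation (Adj G (g x) (g y))
    ¬¬chord-clique c a c<a a≤ℓ e x y c≤x x≤a c≤y y≤a x≢y =
      ¬¬cycle-clique (segment-walk c k (≤-trans (≤-reflexive c+k≡a) a≤ℓ))
        (distinct-segment c (suc k) (subst (_≤ suc ℓ) (sym (+-suc c k)) (s≤s (≤-trans (≤-reflexive c+k≡a) a≤ℓ))))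
        (subst (λ z → Adj G (g z) (g c)) (sym c+k≡a) (Graph.sym G e))
        (∈segment⁺ c (suc k) x c≤x (<c+1+k x≤a)) (∈segment⁺ c (suc k) y c≤y (<c+1+k y≤a))
        (g-≢ (≤-trans x≤a a≤ℓ) (≤-trans y≤a a≤ℓ) x≢y)
      where
        k = a ∸ c
        c+k≡a : c + k ≡ a
        c+k≡a = m+[n∸m]≡n (<⇒≤ c<a)
        <c+1+k : ∀ {z} → z ≤ a → z < c + suc k
        <c+1+k {z} z≤a = subst (z <_) (sym (+-suc c k)) (s≤s (≤-trans z≤a (≤-reflexive (sym c+k≡a))))

    -- Induction on the upper end: to join g x to g (t+1), take a chord g c' ~ g a'
    -- across t; if c' ≤ x it spans both, otherwise g x, g c', g (t+1), g t is a cycle.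
    ¬¬cutFree-clique : ∀ c a → a ≤ ℓ → (∀ m → c < m → m < a → ¬ IsCut m) →
      ∀ x y → c ≤ x → x ≤ a → c ≤ y → y ≤ a → x ≢ y → DoubleNegation (Adj G (g x) (g y))
    ¬¬cutFree-clique c a a≤ℓ noCut = upTo a ≤-refl
      where
        CliqueUpTo : ℕ → Set
        CliqueUpTo t = ∀ x y → c ≤ x → x ≤ t → c ≤ y → y ≤ t → x ≢ y → DoubleNegation (Adj G (g x) (g y))

        g-< : ∀ {i j} → i < j → j ≤ ℓ → g i ≢ g j
        g-< i<j j≤ℓ = g-≢ (≤-trans (<⇒≤ i<j) j≤ℓ) j≤ℓ (<⇒≢ i<j)

        viaChord : ∀ t → t < ℓ → CliqueUpTo t → ∀ x → c ≤ x → x < t →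
          ∀ c' a' → c' < t → t < a' → a' ≤ ℓ → Adj G (g c') (g a') → DoubleNegation (Adj G (g x) (g (suc t)))
        viaChord t t<ℓ clique x c≤x x<t c' a' c'<t t<a' a'≤ℓ chord with c' ≤? x
        ... | yes c'≤x = ¬¬chord-clique c' a' (<-trans c'<t t<a') a'≤ℓ chord x (suc t) c'≤x (<⇒≤ (<-trans x<t t<a'))
                           (<⇒≤ (m<n⇒m<1+n c'<t)) t<a' (<⇒≢ (m<n⇒m<1+n x<t))
        ... | no c'≰x = do
          x~c' ← clique x c' c≤x (<⇒≤ x<t) (≤-trans c≤x (<⇒≤ x<c')) (<⇒≤ c'<t) (<⇒≢ x<c')
          c'~t+1 ← ¬¬chord-clique c' a' (<-trans c'<t t<a') a'≤ℓ chord c' (suc t) ≤-refl (<⇒≤ (<-trans c'<t t<a'))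
                     (<⇒≤ (m<n⇒m<1+n c'<t)) t<a' (<⇒≢ (m<n⇒m<1+n c'<t))
          t~x ← clique t x (≤-trans c≤x (<⇒≤ x<t)) ≤-refl c≤x (<⇒≤ x<t) (≢-sym (<⇒≢ x<t))
          ¬¬cycle-clique (x~c' ∷ʷ c'~t+1 ∷ʷ Graph.sym G (g-adjacent t t<ℓ) ∷ʷ stop (g t)) d t~x
            (here refl) (there (there (here refl))) (g-< (m<n⇒m<1+n x<t) t<ℓ)
          where
            x<c' : x < c'
            x<c' = ≰⇒> c'≰x
            t≤ℓ = <⇒≤ t<ℓ
            d : Distinct (g x ∷ g c' ∷ g (suc t) ∷ g t ∷ [])
            d = (λ { (here eq) → g-< x<c' (≤-trans (<⇒≤ c'<t) t≤ℓ) eq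
                   ; (there (here eq)) → g-< (m<n⇒m<1+n x<t) t<ℓ eq
                   ; (there (there (here eq))) → g-< x<t t≤ℓ eq })
              ∷ (λ { (here eq) → g-< (m<n⇒m<1+n c'<t) t<ℓ eq ; (there (here eq)) → g-< c'<t t≤ℓ eq })
              ∷ (λ { (here eq) → g-< (n<1+n t) t<ℓ (sym eq) })
              ∷ (λ ())
              ∷ []

        toNext : ∀ t → suc t ≤ a → CliqueUpTo t → ∀ x → c ≤ x → x ≤ t → DoubleNegation (Adj G (g x) (g (suc t)))
        toNext t t<a clique x c≤x x≤t with m≤n⇒m<n∨m≡n x≤t
        ... | inj₂ refl = pure (g-adjacent x (<-≤-trans t<a a≤ℓ))
        ... | inj₁ x<t = do
          c' , a' , c'<t , t<a' , a'≤ℓ , chord ← ¬¬chordAcross (noCut t (<-≤-trans (s≤s c≤x) x<t) t<a)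
          viaChord t (<-≤-trans t<a a≤ℓ) clique x c≤x x<t c' a' c'<t t<a' a'≤ℓ chord

        upTo : ∀ t → t ≤ a → CliqueUpTo t
        upTo zero _ x y _ x≤0 _ y≤0 x≢y = ⊥-elim (x≢y (trans (n≤0⇒n≡0 x≤0) (sym (n≤0⇒n≡0 y≤0))))
        upTo (suc t) t<a x y c≤x x≤ c≤y y≤ x≢y with m≤n⇒m<n∨m≡n x≤ | m≤n⇒m<n∨m≡n y≤
        ... | inj₁ x<1+t | inj₁ y<1+t = upTo t (<⇒≤ t<a) x y c≤x (≤-pred x<1+t) c≤y (≤-pred y<1+t) x≢y
        ... | inj₁ x<1+t | inj₂ refl = toNext t t<a (upTo t (<⇒≤ t<a)) x c≤x (≤-pred x<1+t)
        ... | inj₂ refl | inj₁ y<1+t = do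
          e ← toNext t t<a (upTo t (<⇒≤ t<a)) y c≤y (≤-pred y<1+t)
          pure (Graph.sym G e)
        ... | inj₂ refl | inj₂ refl = ⊥-elim (x≢y refl)

    -- If g m, …, g h are pairwise adjacent and m < j < h, then g 0, …, g m, g (j+1), …, g h,
    -- g (m+1), …, g (j−1), g j is a path from g 0 to g j through all of g 0, …, g h.
    ¬¬longPath-through-clique : ∀ m s r → suc (suc m + s) + r ≤ ℓ →
      (∀ x y → m ≤ x → x ≤ suc (suc m + s) + r → m ≤ y → y ≤ suc (suc m + s) + r → x ≢ y →
        DoubleNegation (Adj G (g x) (g y))) →
      DoubleNegation (Σ (List V) λ qs → Walk (g 0) (g (suc m + s)) qs × Distinct qs × AllOnP qs ×
                                         suc (suc (suc m + s) + r) ≤ length qs)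
    ¬¬longPath-through-clique m s r h≤ℓ clique = do
      m~j+1 ← clique m (suc j) ≤-refl (<⇒≤ (<-trans m<j j<h)) (<⇒≤ (m<n⇒m<1+n m<j)) (s≤s (m≤m+n j r))
                (<⇒≢ (m<n⇒m<1+n m<j))
      clique-walk ← ¬¬cliqueWalk (g (suc j)) middle (g j) dK adjacentK
      pure (segment 0 (suc m) ++ K , walk-++ (segment-walk 0 m m≤ℓ) m~j+1 clique-walk ,
            distinct-++ (distinct-segment 0 (suc m) (s≤s m≤ℓ)) dK initial∉K , (λ {_} → onP-all) , ≤-reflexive (sym length≡))
      where
        j = suc m + s
        h = suc j + r
        m<j : m < j
        m<j = s≤s (m≤m+n m s)
        j<h : j < h
        j<h = s≤s (m≤m+n j r)
        j≤ℓ : j ≤ ℓ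
        j≤ℓ = ≤-trans (<⇒≤ j<h) h≤ℓ
        m≤ℓ : m ≤ ℓ
        m≤ℓ = ≤-trans (<⇒≤ m<j) j≤ℓ
        j+1≤ℓ : suc j ≤ ℓ
        j+1≤ℓ = ≤-trans (s≤s (m≤m+n j r)) h≤ℓ
        upper = segment (suc (suc j)) r
        lower = segment (suc m) s
        middle = upper ++ lower
        K = g (suc j) ∷ middle ++ [ g j ]
        ∈K⁻ : ∀ {x} → x ∈ K → Σ ℕ λ t → suc m ≤ t × t ≤ h × x ≡ g t
        ∈K⁻ (here refl) = suc j , s≤s (<⇒≤ m<j) , j<h , refl
        ∈K⁻ (there x∈) with ∈-++⁻ middle x∈
        ... | inj₂ (here refl) = j , m<j , <⇒≤ j<h , refl
        ... | inj₁ x∈middle with ∈-++⁻ upper x∈middle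
        ...   | inj₁ x∈upper = let (t , j+2≤t , t<h+1 , x≡) = ∈segment⁻ (suc (suc j)) r x∈upper in
                               t , ≤-trans (m<n⇒m<1+n (m<n⇒m<1+n m<j)) j+2≤t , ≤-pred t<h+1 , x≡
        ...   | inj₂ x∈lower = let (t , m+1≤t , t<j , x≡) = ∈segment⁻ (suc m) s x∈lower in
                               t , m+1≤t , ≤-trans (<⇒≤ t<j) (<⇒≤ j<h) , x≡
        adjacentK : ∀ {x y} → x ∈ K → y ∈ K → x ≢ y → DoubleNegation (Adj G x y)
        adjacentK x∈ y∈ x≢y with ∈K⁻ x∈ | ∈K⁻ y∈
        ... | t , m<t , t≤h , refl | t' , m<t' , t'≤h , refl =
          clique t t' (<⇒≤ m<t) t≤h (<⇒≤ m<t') t'≤h (λ { refl → x≢y refl })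
        lower≤ : suc m + s ≤ suc ℓ
        lower≤ = ≤-trans (n≤1+n j) (s≤s j≤ℓ)
        dMiddle : Distinct middle
        dMiddle = distinct-++ (distinct-segment (suc (suc j)) r (s≤s h≤ℓ)) (distinct-segment (suc m) s lower≤)
          λ x∈upper → let (t , j+2≤t , t<h+1 , x≡) = ∈segment⁻ (suc (suc j)) r x∈upper in
            subst (_∉ _) (sym x≡) (g∉segment t (suc m) s (≤-pred (≤-trans t<h+1 (s≤s h≤ℓ))) lower≤
                                     (inj₂ (≤-trans (n≤1+n j) (≤-trans (n≤1+n (suc j)) j+2≤t))))
        gj∉middle : g j ∉ middle
        gj∉middle x∈ with ∈-++⁻ upper x∈
        ... | inj₁ x∈upper = g∉segment j (suc (suc j)) r j≤ℓ (s≤s h≤ℓ) (inj₁ (n≤1+n (suc j))) x∈upper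
        ... | inj₂ x∈lower = g∉segment j (suc m) s j≤ℓ lower≤ (inj₂ ≤-refl) x∈lower
        gj+1∉ : g (suc j) ∉ middle ++ [ g j ]
        gj+1∉ x∈ with ∈-++⁻ middle x∈
        ... | inj₂ (here eq) = <⇒≢ (n<1+n j) (sym (g-injective j+1≤ℓ j≤ℓ eq))
        ... | inj₁ x∈middle with ∈-++⁻ upper x∈middle
        ...   | inj₁ x∈upper = g∉segment (suc j) (suc (suc j)) r j+1≤ℓ (s≤s h≤ℓ) (inj₁ (n<1+n (suc j))) x∈upper
        ...   | inj₂ x∈lower = g∉segment (suc j) (suc m) s j+1≤ℓ lower≤ (inj₂ (n≤1+n j)) x∈lower
        dK : Distinct K
        dK = gj+1∉ ∷ distinct-∷ʳ dMiddle gj∉middle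
        initial∉K : ∀ {x} → x ∈ segment 0 (suc m) → x ∉ K
        initial∉K x∈ x∈K with ∈segment⁻ 0 (suc m) x∈ | ∈K⁻ x∈K
        ... | t , _ , t<m+1 , refl | t' , m<t' , t'≤h , eq
          with g-injective (≤-trans (≤-pred t<m+1) m≤ℓ) (≤-trans t'≤h h≤ℓ) eq
        ... | refl = <⇒≱ t<m+1 m<t'
        onP-all : AllOnP (segment 0 (suc m) ++ K)
        onP-all x∈ with ∈-++⁻ (segment 0 (suc m)) x∈
        ... | inj₁ x∈initial = onP-segment 0 (suc m) (s≤s m≤ℓ) x∈initial
        ... | inj₂ x∈K = let (t , _ , t≤h , x≡) = ∈K⁻ x∈K in subst OnP (sym x≡) (onP⁺ t (≤-trans t≤h h≤ℓ))
        length≡ : length (segment 0 (suc m) ++ K) ≡ suc h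
        length≡ = begin
          length (segment 0 (suc m) ++ K)            ≡⟨ length-++ (segment 0 (suc m)) ⟩
          length (segment 0 (suc m)) + length K      ≡⟨ cong₂ _+_ (length-segment 0 (suc m)) (cong suc length-middle) ⟩
          suc m + suc ((r + s) + 1)                  ≡⟨ solve 3 (λ m r s → con 1 :+ m :+ (con 1 :+ ((r :+ s) :+ con 1))
                                                                     := con 1 :+ (con 1 :+ (con 1 :+ m :+ s) :+ r)) refl m r s ⟩
          suc h                                      ∎
          where
            open ≡-Reasoning
            open +-*-Solver
            length-middle : length (middle ++ [ g j ]) ≡ (r + s) + 1
            length-middle = trans (length-++ middle)
              (cong (_+ 1) (trans (length-++ upper) (cong₂ _+_ (length-segment _ r) (length-segment _ s))))

    LongerFromStart : ℕ → List V → Set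
    LongerFromStart j rs = Σ (List V) λ qs → Walk (g 0) (g j) qs × Distinct qs × AllOnP qs × length rs ≤ length qs

    private
      path-length≤ : ∀ h → IsCut h → h ≤ ℓ → ∀ {i j rs} → i ≤ h → j ≤ h →
        Walk (g i) (g j) rs → Distinct rs → AllOnP rs → length rs ≤ suc h
      path-length≤ h cut h≤ℓ {i} {j} {rs} i≤h j≤h π drs onP = begin
        length rs                    ≤⟨ distinct-length-≤ drs rs⊆ ⟩
        length (segment 0 (suc h))   ≡⟨ length-segment 0 (suc h) ⟩
        suc h                        ∎
        where
          open ≤-Reasoning
          rs⊆ : ∀ {z} → z ∈ rs → z ∈ segment 0 (suc h)
          rs⊆ z∈ with onP⁻ (onP z∈)
          ... | t , t≤ℓ , refl = ∈segment⁺ 0 (suc h) t z≤n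
            (s≤s (path-below-cut h cut π drs onP i j (≤-trans i≤h h≤ℓ) (≤-trans j≤h h≤ℓ) refl refl i≤h j≤h
                                 z∈ t t≤ℓ refl))

      ¬¬longer-via-clique : ∀ m s r {j h} rs → j ≡ suc m + s → h ≡ suc j + r → h ≤ ℓ → length rs ≤ suc h →
        (∀ m' → m < m' → m' < h → ¬ IsCut m') → DoubleNegation (LongerFromStart j rs)
      ¬¬longer-via-clique m s r rs refl refl h≤ℓ rs≤ noCut = do
        qs , 0→j , dqs , onP , h<qs ← ¬¬longPath-through-clique m s r h≤ℓ (¬¬cutFree-clique m _ h≤ℓ noCut)
        pure (qs , 0→j , dqs , (λ {_} → onP) , ≤-trans rs≤ h<qs)

    -- A path on g from g i to g j, i ≤ j, can be replaced by an at least as long path on g from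
    -- g 0 to g j: with cuts m < j ≤ h around j and no cut in between, the vertices g m, …, g h
    -- form a clique, through which the path can be rerouted.
    ¬¬longerFromStart : ∀ {rs} i j → i ≤ j → j ≤ ℓ → Walk (g i) (g j) rs → Distinct rs → AllOnP rs →
      DoubleNegation (LongerFromStart j rs)
    ¬¬longerFromStart {rs} i j i≤j j≤ℓ π drs onP = do
      h , j≤h , h≤ , cut-h , noCut-j-h ← ¬¬leastAbove IsCut j (ℓ ∸ j) (subst IsCut (sym (m+[n∸m]≡n j≤ℓ)) isCut-ℓ)
      aroundJ h j≤h (≤-trans h≤ (≤-reflexive (m+[n∸m]≡n j≤ℓ))) cut-h noCut-j-h
      where
        aroundJ : ∀ h → j ≤ h → h ≤ ℓ → IsCut h → (∀ m → j ≤ m → m < h → ¬ IsCut m) →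
          DoubleNegation (LongerFromStart j rs)
        aroundJ h j≤h h≤ℓ cut-h noCut-j-h with m≤n⇒m<n∨m≡n j≤h
        ... | inj₂ refl = pure (segment 0 (suc j) , segment-walk 0 j j≤ℓ , distinct-segment 0 (suc j) (s≤s j≤ℓ) ,
                                (λ {_} → onP-segment 0 (suc j) (s≤s j≤ℓ)) ,
                                subst (length rs ≤_) (sym (length-segment 0 (suc j)))
                                      (path-length≤ j cut-h j≤ℓ i≤j ≤-refl π drs onP))
        ... | inj₁ j<h = do
          m , m≤j , cut-m , noCut-m-j ← ¬¬greatestBelow IsCut isCut-0 j
          let m<j = ≤∧≢⇒< m≤j (λ { refl → noCut-j-h m ≤-refl j<h cut-m })
          ¬¬longer-via-clique m (j ∸ suc m) (h ∸ suc j) rs (sym (m+[n∸m]≡n m<j)) (sym (m+[n∸m]≡n j<h)) h≤ℓ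
            (path-length≤ h cut-h h≤ℓ (≤-trans i≤j j≤h) j≤h π drs onP)
            λ m' m<m' m'<h → [ noCut-m-j m' m<m' , (λ j<m' → noCut-j-h m' (<⇒≤ j<m') m'<h) ]′ (≤-<-connex m' j)

    module Longest (longest : ∀ {xs} → Walk (g 0) (g ℓ) xs → Distinct xs → length xs ≤ suc ℓ) where

      -- A vertex off g adjacent to g a and g (a+1) could be inserted between them.
      ¬detour : ∀ {o a} → ¬ OnP o → suc a ≤ ℓ → Adj G (g a) o → Adj G o (g (suc a)) → ⊥
      ¬detour {o} {a} o-off a<ℓ e₁ e₂ = 1+n≰n (begin
          suc (suc ℓ) ≡⟨ length≡ ⟨
          length N    ≤⟨ longest (subst (λ z → Walk (g 0) (g z) N) a+1+k≡ℓ walk) dN ⟩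
          suc ℓ       ∎)
        where
          open ≤-Reasoning
          k = ℓ ∸ suc a
          a+1+k≡ℓ : suc a + k ≡ ℓ
          a+1+k≡ℓ = m+[n∸m]≡n a<ℓ
          upper≤ : suc a + suc k ≤ suc ℓ
          upper≤ = ≤-reflexive (trans (+-suc (suc a) k) (cong suc a+1+k≡ℓ))
          N = segment 0 (suc a) ++ o ∷ segment (suc a) (suc k)
          walk : Walk (g 0) (g (suc a + k)) N
          walk = walk-++ (segment-walk 0 a (<⇒≤ a<ℓ)) e₁ (e₂ ∷ʷ segment-walk (suc a) k (≤-reflexive a+1+k≡ℓ))
          disjoint : ∀ {x} → x ∈ segment 0 (suc a) → x ∉ o ∷ segment (suc a) (suc k)
          disjoint x∈ (here refl) = o-off (onP-segment 0 (suc a) (s≤s (<⇒≤ a<ℓ)) x∈)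
          disjoint x∈ (there x∈') with ∈segment⁻ 0 (suc a) x∈
          ... | t , _ , t<a+1 , refl =
            g∉segment t (suc a) (suc k) (≤-trans (≤-pred t<a+1) (<⇒≤ a<ℓ)) upper≤ (inj₁ t<a+1) x∈'
          dN : Distinct N
          dN = distinct-++ (distinct-segment 0 (suc a) (s≤s (<⇒≤ a<ℓ)))
                 ((o-off ∘ onP-segment (suc a) (suc k) upper≤) ∷ distinct-segment (suc a) (suc k) upper≤) disjoint
          length≡ : length N ≡ suc (suc ℓ)
          length≡ = begin-equality
            length N                        ≡⟨ length-++ (segment 0 (suc a)) ⟩
            length (segment 0 (suc a)) + suc (length (segment (suc a) (suc k)))
                                            ≡⟨ cong₂ (λ x y → x + suc y) (length-segment 0 (suc a)) (length-segment (suc a) (suc k)) ⟩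
            suc a + suc (suc k)             ≡⟨ +-suc (suc a) (suc k) ⟩
            suc (suc a + suc k)             ≡⟨ cong suc (+-suc (suc a) k) ⟩
            suc (suc (suc a + k))           ≡⟨ cong (suc ∘ suc) a+1+k≡ℓ ⟩
            suc (suc ℓ)                     ∎

      -- An excursion g a, os, g b off g closes a cycle with g b, …, g (a+1), so any vertex of os
      -- is adjacent to g a and to g (a+1).
      ¬excursion : ∀ a b os → a < b → b ≤ ℓ → Walk (g a) (g b) (g a ∷ os ++ [ g b ]) → Distinct (g a ∷ os ++ [ g b ]) →
        (∀ {z} → z ∈ os → ¬ OnP z) → ∀ {o} → o ∈ os → ⊥
      ¬excursion a b os a<b b≤ℓ a→b d os-off {o} o∈ = go (b ∸ suc a) (m+[n∸m]≡n a<b)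
        where
          a<ℓ : a < ℓ
          a<ℓ = <-≤-trans a<b b≤ℓ
          go : ∀ k → suc a + k ≡ b → ⊥
          go k refl = ¬¬⊥ (λ ())
            where
              R = reverse (segment (suc a) k)
              reverse-segment≡ : reverse (segment (suc a) (suc k)) ≡ g (suc a + k) ∷ R
              reverse-segment≡ = trans (cong reverse (segment-∷ʳ (suc a) k)) (reverse-++ (segment (suc a) k) [ _ ])
              back : Walk (g (suc a + k)) (g (suc a)) (g (suc a + k) ∷ R)
              back = subst (Walk _ _) reverse-segment≡ (walk-reverse (segment-walk (suc a) k b≤ℓ))
              C = (g a ∷ os) ++ g (suc a + k) ∷ R
              segment≤ : suc a + k ≤ suc ℓ
              segment≤ = ≤-trans (n≤1+n _) (s≤s b≤ℓ)
              dC : Distinct C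
              dC = ga∉ ∷ distinct-++ (distinct-++ˡ os (distinct-tail d))
                                     (gb∉R ∷ distinct-reverse (distinct-segment (suc a) k segment≤))
                     λ { z∈os (here refl) → os-off z∈os (onP⁺ _ b≤ℓ)
                       ; z∈os (there z∈R) → os-off z∈os (onP-segment (suc a) k segment≤ (reverse⁻ z∈R)) }
                where
                  gb∉R : g (suc a + k) ∉ R
                  gb∉R = g∉segment (suc a + k) (suc a) k b≤ℓ segment≤ (inj₂ ≤-refl) ∘ reverse⁻
                  ga∉ : g a ∉ os ++ g (suc a + k) ∷ R
                  ga∉ x∈ with ∈-++⁻ os x∈
                  ... | inj₁ ga∈os = distinct-head d (∈-++⁺ˡ ga∈os)
                  ... | inj₂ (here eq) = distinct-head d (∈-++⁺ʳ os (here eq))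
                  ... | inj₂ (there ga∈R) = g∉segment a (suc a) k (<⇒≤ a<ℓ) segment≤ (inj₁ (n<1+n a)) (reverse⁻ ga∈R)
              ga+1∈C : g (suc a) ∈ C
              ga+1∈C = ∈-++⁺ʳ (g a ∷ os)
                         (subst (g (suc a) ∈_) reverse-segment≡ (reverse⁺ {xs = segment (suc a) (suc k)} (here refl)))
              o∈C : o ∈ C
              o∈C = there (∈-++⁺ˡ o∈)
              ¬¬⊥ : DoubleNegation ⊥
              ¬¬⊥ = do
                let cycle = walk-glue (g a ∷ os) a→b back
                    closing = Graph.sym G (g-adjacent a a<ℓ)
                e₁ ← ¬¬cycle-clique cycle dC closing (here refl) o∈C (λ { refl → os-off o∈ (onP⁺ a (<⇒≤ a<ℓ)) })
                e₂ ← ¬¬cycle-clique cycle dC closing o∈C ga+1∈C (λ { refl → os-off o∈ (onP⁺ (suc a) a<ℓ) })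
                pure (¬detour (os-off o∈) a<ℓ e₁ e₂)

      -- Every vertex of a path between two vertices on g is on g: otherwise the maximal stretch
      -- of the path off g around that vertex would be an excursion.
      path-onP : ∀ {u v rs} → Walk u v rs → Distinct rs → OnP u → OnP v → AllOnP rs
      path-onP {u} {v} π drs u-on v-on {o} o∈ with OnP? o
      ... | yes o-on = o-on
      ... | no o-off = ⊥-elim (stretch (∈-∃++ o∈))
        where
          stretch : (Σ (List V) λ X → Σ (List V) λ Y → _ ≡ X ++ o ∷ Y) → ⊥
          stretch (X , Y , refl) with splitAtFirst OnP? (reverse X) (lose (reverse⁺ u∈X) u-on)
                                    | splitAtFirst OnP? Y (lose v∈Y v-on)
            where
              u∈X : u ∈ X
              u∈X with ∈-++⁻ X (source∈ (walk-upTo X π))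
              ... | inj₁ u∈X = u∈X
              ... | inj₂ (here refl) = ⊥-elim (o-off u-on)
              v∈Y : v ∈ Y
              v∈Y with target∈ (walk-from X π)
              ... | here refl = ⊥-elim (o-off v-on)
              ... | there v∈Y = v∈Y
          ... | A₁ , s , A₂ , revX≡ , s-on , A₁-off | B₁ , t , B₂ , refl , t-on , B₁-off = ends (onP⁻ s-on) (onP⁻ t-on)
            where
              X≡ : X ≡ reverse A₂ ++ s ∷ reverse A₁
              X≡ = reverse-≡-++-∷ X A₁ s A₂ revX≡
              os = reverse A₁ ++ o ∷ B₁
              E = s ∷ os ++ [ t ]
              rs≡ : X ++ o ∷ B₁ ++ t ∷ B₂ ≡ reverse A₂ ++ E ++ B₂
              rs≡ = begin
                X ++ o ∷ B₁ ++ t ∷ B₂                            ≡⟨ cong (_++ o ∷ B₁ ++ t ∷ B₂) X≡ ⟩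
                (reverse A₂ ++ s ∷ reverse A₁) ++ o ∷ B₁ ++ t ∷ B₂ ≡⟨ ++-assoc (reverse A₂) (s ∷ reverse A₁) _ ⟩
                reverse A₂ ++ s ∷ (reverse A₁ ++ o ∷ B₁ ++ t ∷ B₂) ≡⟨ cong (λ z → reverse A₂ ++ s ∷ z)
                                                                            (++-assoc (reverse A₁) (o ∷ B₁) (t ∷ B₂)) ⟨
                reverse A₂ ++ s ∷ (os ++ t ∷ B₂)                 ≡⟨ cong (λ z → reverse A₂ ++ s ∷ z) (++-assoc os [ t ] B₂) ⟨
                reverse A₂ ++ E ++ B₂                            ∎
                where open ≡-Reasoning
              dE : Distinct E
              dE = distinct-++ˡ E (distinct-++ʳ (reverse A₂) (subst Distinct rs≡ drs))
              s→o : Walk s o (s ∷ reverse A₁ ++ [ o ])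
              s→o = walk-from (reverse A₂)
                      (subst (Walk u o) (trans (cong (_++ [ o ]) X≡) (++-assoc (reverse A₂) (s ∷ reverse A₁) [ o ]))
                             (walk-upTo X π))
              s→t : Walk s t E
              s→t = subst (Walk s t) (cong (s ∷_) (sym (++-assoc (reverse A₁) (o ∷ B₁) [ t ])))
                      (walk-glue (s ∷ reverse A₁) s→o (walk-upTo (o ∷ B₁) (walk-from X π)))
              os-off : ∀ {z} → z ∈ os → ¬ OnP z
              os-off z∈ with ∈-++⁻ (reverse A₁) z∈
              ... | inj₁ z∈A₁ = A₁-off (reverse⁻ z∈A₁)
              ... | inj₂ (here refl) = o-off
              ... | inj₂ (there z∈B₁) = B₁-off z∈B₁
              o∈os : o ∈ os
              o∈os = ∈-++⁺ʳ (reverse A₁) (here refl)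
              ends : (Σ ℕ λ a → a ≤ ℓ × s ≡ g a) → (Σ ℕ λ b → b ≤ ℓ × t ≡ g b) → ⊥
              ends (a , a≤ℓ , refl) (b , b≤ℓ , refl) with <-cmp a b
              ... | tri< a<b _ _ = ¬excursion a b os a<b b≤ℓ s→t dE os-off o∈os
              ... | tri≈ _ refl _ = distinct-head dE (∈-++⁺ʳ os (here refl))
              ... | tri> _ _ b<a = ¬excursion b a (reverse os) b<a a≤ℓ
                                     (subst (Walk (g b) (g a)) reverse-E≡ (walk-reverse s→t))
                                     (subst Distinct reverse-E≡ (distinct-reverse dE))
                                     (os-off ∘ reverse⁻) (reverse⁺ o∈os)
                where
                  reverse-E≡ : reverse E ≡ g b ∷ reverse os ++ [ g a ]
                  reverse-E≡ = begin
                    reverse (g a ∷ os ++ [ g b ])      ≡⟨ unfold-reverse (g a) (os ++ [ g b ]) ⟩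
                    reverse (os ++ [ g b ]) ++ [ g a ] ≡⟨ cong (_++ [ g a ]) (reverse-++ os [ g b ]) ⟩
                    g b ∷ reverse os ++ [ g a ]        ∎
                    where open ≡-Reasoning

      splitAtLastOnP : ∀ i → i ≤ ℓ → ∀ y →
        Σ ℕ λ j → j ≤ ℓ × Σ (List V) λ R → Σ (List V) λ T →
          Walk (g i) (g j) R × Distinct R × AllOnP R × Walk (g j) y (g j ∷ T) × Distinct (g j ∷ T) ×
          (∀ {z} → z ∈ T → ¬ OnP z) × suc (D (g i) y) ≡ length R + length T
      splitAtLastOnP i i≤ℓ y with longestPath (g i) y
      ... | rs , π , drs , length≡ with splitAtFirst OnP? (reverse rs) (lose (reverse⁺ (source∈ π)) (onP⁺ i i≤ℓ))
      ... | as , z , bs , revrs≡ , z-on , as-off with onP⁻ z-on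
      ... | j , j≤ℓ , refl =
        j , j≤ℓ , reverse bs ++ [ g j ] , reverse as , i→j , dR , path-onP i→j dR (onP⁺ i i≤ℓ) z-on ,
        walk-from (reverse bs) π′ , distinct-++ʳ (reverse bs) drs′ , as-off ∘ reverse⁻ , length≡′
        where
          rs≡ = reverse-≡-++-∷ rs as (g j) bs revrs≡
          π′ = subst (Walk (g i) y) rs≡ π
          drs′ = subst Distinct rs≡ drs
          i→j = walk-upTo (reverse bs) π′
          dR = distinct-prefix (reverse bs) drs′
          length≡′ : suc (D (g i) y) ≡ length (reverse bs ++ [ g j ]) + length (reverse as)
          length≡′ = begin
            suc (D (g i) y)                                      ≡⟨ length≡ ⟨
            length rs                                            ≡⟨ cong length rs≡ ⟩
            length (reverse bs ++ g j ∷ reverse as)              ≡⟨ cong length (++-assoc (reverse bs) [ g j ] (reverse as)) ⟨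
            length ((reverse bs ++ [ g j ]) ++ reverse as)       ≡⟨ length-++ (reverse bs ++ [ g j ]) ⟩
            length (reverse bs ++ [ g j ]) + length (reverse as) ∎
            where open ≡-Reasoning

  open Eccentricity D

  -- Every vertex g i of a longest path g between central vertices is central: a longest path
  -- from g i to any y leaves g at its last vertex g j on g, and stays on g up to there; that
  -- part can be replaced by an at least as long path from an end of g to g j.
  module CentralPath {w w' : V} (cw : isCentral D w) (cw' : isCentral D w') where

    private
      ℓ : ℕ
      ℓ = D w w'

      π : Path G w w' ℓ
      π = proj₁ (isD w w')

    g : ℕ → V
    g = vertexAt π

    g⃖ : ℕ → V
    g⃖ t = g (ℓ ∸ t)

    private
      g⃖-injective : ∀ {i j} → i ≤ ℓ → j ≤ ℓ → g⃖ i ≡ g⃖ j → i ≡ j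
      g⃖-injective {i} {j} i≤ℓ j≤ℓ eq =
        ∸-cancelˡ-≡ i≤ℓ j≤ℓ (vertexAt-injective π (m∸n≤m ℓ i) (m∸n≤m ℓ j) eq)

      ℓ∸t≡1+ℓ∸1+t : ∀ {t} → t < ℓ → ℓ ∸ t ≡ suc (ℓ ∸ suc t)
      ℓ∸t≡1+ℓ∸1+t t<ℓ = +-∸-assoc 1 t<ℓ

      g⃖-adjacent : ∀ t → t < ℓ → Adj G (g⃖ t) (g⃖ (suc t))
      g⃖-adjacent t t<ℓ = subst (λ z → Adj G (g z) (g (ℓ ∸ suc t))) (sym (ℓ∸t≡1+ℓ∸1+t t<ℓ))
        (Graph.sym G (vertexAt-adjacent π (ℓ ∸ suc t)
          (≤-trans (≤-reflexive (sym (ℓ∸t≡1+ℓ∸1+t t<ℓ))) (m∸n≤m ℓ t))))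

    module Fwd = AlongPath ℓ g (vertexAt-injective π) (vertexAt-adjacent π)
    module Bwd = AlongPath ℓ g⃖ g⃖-injective g⃖-adjacent

    private
      g⃖-ℓ∸ : ∀ {t} → t ≤ ℓ → g⃖ (ℓ ∸ t) ≡ g t
      g⃖-ℓ∸ t≤ℓ = cong g (m∸[m∸n]≡n t≤ℓ)

      longest : ∀ {xs} → Walk (g 0) (g ℓ) xs → Distinct xs → length xs ≤ suc ℓ
      longest ρ = length≤1+D (subst₂ (λ a b → Walk a b _) (vertexAt-0 π) (vertexAt-ℓ π) ρ)

      Bwd⇒Fwd : ∀ {z} → Bwd.OnP z → Fwd.OnP z
      Bwd⇒Fwd onP with Bwd.onP⁻ onP
      ... | t , _ , refl = Fwd.onP⁺ (ℓ ∸ t) (m∸n≤m ℓ t)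

      Fwd⇒Bwd : ∀ {z} → Fwd.OnP z → Bwd.OnP z
      Fwd⇒Bwd onP with Fwd.onP⁻ onP
      ... | t , t≤ℓ , refl = subst Bwd.OnP (g⃖-ℓ∸ t≤ℓ) (Bwd.onP⁺ (ℓ ∸ t) (m∸n≤m ℓ t))

    open ≤-Reasoning

    D≤ecc-start : ∀ i → i ≤ ℓ → ∀ y → D (g i) y ≤ ecc D w
    D≤ecc-start i i≤ℓ y with Fwd.Longest.splitAtLastOnP longest i i≤ℓ y
    ... | j , j≤ℓ , R , T , i→j , dR , R-on , j→y , dT , T-off , 1+D≡ with i ≤? j
    ... | yes i≤j = decidable-stable (_ ≤? _) do
          qs , 0→j , dqs , qs-on , R≤qs ← Fwd.¬¬longerFromStart i j i≤j j≤ℓ i→j dR R-on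
          pure (≤-trans (≤-pred (begin
            suc (D (g i) y)          ≡⟨ 1+D≡ ⟩
            length R + length T      ≤⟨ +-monoˡ-≤ (length T) R≤qs ⟩
            length qs + length T     ≤⟨ ++-length≤1+D Fwd.OnP 0→j dqs qs-on j→y dT T-off ⟩
            suc (D (g 0) y)          ∎))
            (subst (λ z → D z y ≤ ecc D w) (sym (vertexAt-0 π)) (D≤ecc w y)))
    ... | no i≰j = decidable-stable (_ ≤? _) do
          qs , ℓ→j , dqs , qs-on , R≤qs ←
            Bwd.¬¬longerFromStart (ℓ ∸ i) (ℓ ∸ j) (∸-monoʳ-≤ ℓ (<⇒≤ (≰⇒> i≰j))) (m∸n≤m ℓ j)
                                            (subst₂ (λ a b → Walk a b R) (sym (g⃖-ℓ∸ i≤ℓ)) (sym (g⃖-ℓ∸ j≤ℓ)) i→j)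
                                            dR (Fwd⇒Bwd ∘ R-on)
          pure (≤-trans (≤-pred (begin
            suc (D (g i) y)          ≡⟨ 1+D≡ ⟩
            length R + length T      ≤⟨ +-monoˡ-≤ (length T) R≤qs ⟩
            length qs + length T     ≤⟨ ++-length≤1+D Fwd.OnP (subst (λ b → Walk (g ℓ) b qs) (g⃖-ℓ∸ j≤ℓ) ℓ→j) dqs
                                                     (Bwd⇒Fwd ∘ qs-on) j→y dT T-off ⟩
            suc (D (g ℓ) y)          ∎))
            (≤-trans (subst (λ z → D z y ≤ ecc D w') (sym (vertexAt-ℓ π)) (D≤ecc w' y)) (cw' w)))

    central : ∀ t → t ≤ ℓ → isCentral D (g t)
    central t t≤ℓ x = ≤-trans (ecc-lub (g t) (ecc D w) (D≤ecc-start t t≤ℓ)) (cw x)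

  -- The 1 + D(w, w') vertices of a longest path between central vertices are all central.
  1+D≤omega : ∀ {w w'} → isCentral D w → isCentral D w' → suc (D w w') ≤ omega D
  1+D≤omega {w} {w'} cw cw' = begin
    suc (D w w')                   ≡⟨ Fwd.length-segment 0 (suc (D w w')) ⟨
    length (Fwd.segment 0 (suc (D w w'))) ≤⟨ distinct-length≤∣p∣ (Fwd.distinct-segment 0 (suc (D w w')) ≤-refl) all-central ⟩
    omega D                         ∎
    where
      open ≤-Reasoning
      open CentralPath cw cw'
      all-central : ∀ {x} → x ∈ Fwd.segment 0 (suc (D w w')) → x ∈ˢ centerSet D
      all-central x∈ with Fwd.∈segment⁻ 0 (suc (D w w')) x∈
      ... | t , _ , t<1+ℓ , refl = isCentral⇒∈centerSet (central t (≤-pred t<1+ℓ))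

module BlockGraphLevels {n : ℕ} (G : Graph (suc n)) (blockGraph : IsBlockGraph G)
                        (D : Fin (suc n) → Fin (suc n) → ℕ) (isD : IsDetourDistance G D) where
  open Detour G (proj₁ blockGraph) D isD using (D-triangle)
  open BlockGraph G blockGraph D isD using (1+D≤omega; ¬¬∃block-∣B∣∸1≤D)
  open Eccentricity D using (isCentral?; 2≤omega)
  open Levels D

  private
    V : Set
    V = Fin (suc n)

  D≤level+level+ω∸1 : ∀ u v → D u v ≤ level D u + level D v + (omega D ∸ 1)
  D≤level+level+ω∸1 u v with level-attained u | level-attained v
  ... | w , cw , level≡ | w' , cw' , level≡' = begin
    D u v                                 ≤⟨ D-triangle w u v ⟩
    D w u + D w v                         ≤⟨ +-monoʳ-≤ (D w u) (D-triangle w' w v) ⟩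
    D w u + (D w' w + D w' v)             ≤⟨ +-monoʳ-≤ (D w u) (+-monoˡ-≤ (D w' v) (∸-monoˡ-≤ 1 (1+D≤omega cw' cw))) ⟩
    D w u + (omega D ∸ 1 + D w' v)        ≡⟨ +-assoc (D w u) _ _ ⟨
    D w u + (omega D ∸ 1) + D w' v        ≡⟨ +-assoc (D w u) _ _ ⟩
    D w u + ((omega D ∸ 1) + D w' v)      ≡⟨ cong (D w u +_) (+-comm (omega D ∸ 1) _) ⟩
    D w u + (D w' v + (omega D ∸ 1))      ≡⟨ +-assoc (D w u) _ _ ⟨
    D w u + D w' v + (omega D ∸ 1)        ≡⟨ cong₂ (λ a b → a + b + (omega D ∸ 1)) level≡ level≡' ⟨
    level D u + level D v + (omega D ∸ 1) ∎
    where open ≤-Reasoning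

  module _ {ξ : ℕ} (isXi : IsXi G D ξ) where

    ξ≤level : omega D ≡ 1 → ∀ u → ¬ isCentral D u → ξ ≤ level D u
    ξ≤level ω≡1 u ¬central with level-attained u
    ... | w , cw , level≡ = subst (ξ ≤_) (sym level≡) (decidable-stable (_ ≤? _) do
      B , block , w∈B , ∣B∣∸1≤D ← ¬¬∃block-∣B∣∸1≤D w u (λ { refl → ¬central cw })
      pure (≤-trans (proj₂ (proj₁ isXi ω≡1 w cw) B block w∈B) ∣B∣∸1≤D))

    -- Of two distinct vertices at most one is the unique central vertex.
    ξ≤level+level : ∀ t b → (t ≡ b → n ≡ 0) → ξ ≤ level D t + level D b
    ξ≤level+level t b t≡b⇒n≡0 with 2 ≤? omega D
    ... | yes 2≤ω = subst (_≤ _) (sym (proj₂ isXi 2≤ω)) z≤n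
    ... | no 2≰ω = unique-center (≤-antisym (≤-pred (≰⇒> 2≰ω)) 1≤omega)
      where
        unique-center : omega D ≡ 1 → ξ ≤ level D t + level D b
        unique-center ω≡1 with t FP.≟ b | isCentral? t | isCentral? b
        ... | yes refl | _ | _ = begin
          ξ               ≡⟨ proj₂ (proj₂ (proj₂ (proj₁ (proj₁ isXi ω≡1 _ (proj₂ ∃central))))) ⟩
          ∣ B ∣ ∸ 1       ≤⟨ ∸-monoˡ-≤ 1 (SP.∣p∣≤n B) ⟩
          n               ≡⟨ t≡b⇒n≡0 refl ⟩
          0               ≤⟨ z≤n ⟩
          level D t + level D t ∎
          where open ≤-Reasoning
                B = proj₁ (proj₁ (proj₁ isXi ω≡1 _ (proj₂ ∃central)))
        ... | no t≢b | yes ct | yes cb = ⊥-elim (1+n≰n (subst (2 ≤_) ω≡1 (2≤omega t≢b ct cb)))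
        ... | no _ | no ¬ct | _ = ≤-trans (ξ≤level ω≡1 t ¬ct) (m≤m+n _ _)
        ... | no _ | yes _ | no ¬cb = ≤-trans (ξ≤level ω≡1 b ¬cb) (m≤n+m _ _)

private
  module GapArithmetic where
    open +-*-Solver

    gap-step : ∀ n k Lm Lt Lb K ct d s → n ≤ Lm + Lt + K + d → k * n + Lt + Lb ≤ ct + 2 * s + k * K →
           suc k * n + Lm + Lb ≤ (ct + d) + 2 * (s + Lm) + suc k * K
    gap-step n k Lm Lt Lb K ct d s gap ih =
      subst₂ _≤_ e₃ e₄ (+-monoˡ-≤ Lm (+-cancelʳ-≤ Lt _ _ (subst₂ _≤_ e₁ e₂ (+-mono-≤ gap ih))))
      where
        e₁ : n + (k * n + Lt + Lb) ≡ (suc k * n + Lb) + Lt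
        e₁ = solve 4 (λ n k Lt Lb → n :+ (k :* n :+ Lt :+ Lb) := (con 1 :+ k) :* n :+ Lb :+ Lt) refl n k Lt Lb
        e₂ : (Lm + Lt + K + d) + (ct + 2 * s + k * K) ≡ (ct + d + 2 * s + Lm + suc k * K) + Lt
        e₂ = solve 7 (λ Lm Lt K d ct s k → (Lm :+ Lt :+ K :+ d) :+ (ct :+ con 2 :* s :+ k :* K)
                      := (ct :+ d :+ con 2 :* s :+ Lm :+ (con 1 :+ k) :* K) :+ Lt) refl Lm Lt K d ct s k
        e₃ : (suc k * n + Lb) + Lm ≡ suc k * n + Lm + Lb
        e₃ = solve 4 (λ n k Lb Lm → ((con 1 :+ k) :* n :+ Lb) :+ Lm := (con 1 :+ k) :* n :+ Lm :+ Lb) refl n k Lb Lm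
        e₄ : (ct + d + 2 * s + Lm + suc k * K) + Lm ≡ (ct + d) + 2 * (s + Lm) + suc k * K
        e₄ = solve 6 (λ ct d s Lm k K → (ct :+ d :+ con 2 :* s :+ Lm :+ (con 1 :+ k) :* K) :+ Lm
                      := (ct :+ d) :+ con 2 :* (s :+ Lm) :+ (con 1 :+ k) :* K) refl ct d s Lm k K

    gap-base : ∀ cb x n K → 0 * n + x + x ≤ cb + 2 * (x + 0) + 0 * K
    gap-base cb x n K = ≤-trans (m≤n+m (x + x) cb)
      (≤-reflexive (solve 2 (λ cb x → cb :+ (x :+ x) := cb :+ con 2 :* (x :+ con 0) :+ con 0) refl cb x))

-- Walking through the vertices in order of increasing color, each of the n gaps is at least
-- n − L(u) − L(v) − K; every vertex occurs in two consecutive pairs except the first and the last.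
module ColorGaps {n : ℕ} (c L : Fin (suc n) → ℕ) (K : ℕ)
                 (gap : ∀ u v → u ≢ v → n ≤ L u + L v + K + ∣ c u - c v ∣) where

  private
    V : Set
    V = Fin (suc n)

  ΣL : List V → ℕ
  ΣL xs = LA.sum (map L xs)

  ΣL-remove : ∀ as m bs → ΣL (as ++ m ∷ bs) ≡ L m + ΣL (as ++ bs)
  ΣL-remove as m bs = begin
    ΣL (as ++ m ∷ bs)            ≡⟨ cong LA.sum (map-++ L as (m ∷ bs)) ⟩
    LA.sum (map L as ++ map L (m ∷ bs)) ≡⟨ LAP.sum-++ (map L as) _ ⟩
    ΣL as + (L m + ΣL bs)       ≡⟨ +-comm (ΣL as) _ ⟩
    (L m + ΣL bs) + ΣL as       ≡⟨ +-assoc (L m) _ _ ⟩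
    L m + (ΣL bs + ΣL as)       ≡⟨ cong (L m +_) (+-comm (ΣL bs) _) ⟩
    L m + (ΣL as + ΣL bs)       ≡⟨ cong (L m +_) (LAP.sum-++ (map L as) _) ⟨
    L m + LA.sum (map L as ++ map L bs) ≡⟨ cong (λ z → L m + LA.sum z) (map-++ L as bs) ⟨
    L m + ΣL (as ++ bs)         ∎
    where open ≡-Reasoning

  -- Opaque so that the goals below do not unfold the argmin computation.
  opaque
    first : V
    first = argmin c F.zero (L.allFin (suc n))

    first-min : ∀ x → c first ≤ c x
    first-min x = All.lookup (f[argmin]≤f[xs] {f = c} F.zero (L.allFin (suc n))) (∈-allFin x)

  ∃max : ∀ x xs → Σ V λ m → m ∈ x ∷ xs × (∀ {y} → y ∈ x ∷ xs → c y ≤ c m)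
  ∃max x xs = argmax c x xs , [ here , there ]′ (argmax-sel c x xs) ,
    λ { (here refl) → f[⊥]≤f[argmax] {f = c} x xs ; (there y∈) → All.lookup (f[xs]≤f[argmax] {f = c} x xs) y∈ }

  Last : ℕ → List V → Set
  Last k xs = Σ V λ t → t ∈ first ∷ xs × (∀ {x} → x ∈ first ∷ xs → c x ≤ c t) × (t ≡ first → xs ≡ []) ×
                k * n + L t + L first ≤ c t + 2 * ΣL (first ∷ xs) + k * K

  -- By induction on the number of vertices, removing one of largest color.
  ∃last : ∀ k xs → length xs ≡ k → Distinct (first ∷ xs) → Last k xs
  ∃last zero [] refl _ =
    first , here refl , (λ { (here refl) → ≤-refl }) , (λ _ → refl) , GapArithmetic.gap-base (c first) (L first) n K
  ∃last (suc k) (x ∷ xs) length≡ (first∉ ∷ dxs) with ∃max x xs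
  ... | m , m∈ , m-max with ∈-∃++ m∈
  ... | as , bs , xs≡ = extend (∃last k (as ++ bs) length-rest (first∉ ∘ rest⊆ ∷ distinct-remove as dxs′))
    where
      dxs′ : Distinct (as ++ m ∷ bs)
      dxs′ = subst Distinct xs≡ dxs
      length-rest : length (as ++ bs) ≡ k
      length-rest = suc-injective (trans (sym (length-remove as)) (trans (cong length (sym xs≡)) length≡))
      rest⊆ : ∀ {y} → y ∈ as ++ bs → y ∈ x ∷ xs
      rest⊆ y∈ = subst (_ ∈_) (sym xs≡) (∈-remove as y∈)
      m∉rest : m ∉ as ++ bs
      m∉rest m∈rest with ∈-++⁻ as m∈rest
      ... | inj₁ m∈as = distinct-++-disjoint as dxs′ m∈as (here refl)
      ... | inj₂ m∈bs = distinct-head (distinct-++ʳ as dxs′) m∈bs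
      m∉first∷rest : m ∉ first ∷ as ++ bs
      m∉first∷rest (here refl) = first∉ m∈
      m∉first∷rest (there m∈rest) = m∉rest m∈rest
      ∈-∷-map : ∀ {y} → (∀ {z} → z ∈ as ++ bs → z ∈ x ∷ xs) → y ∈ first ∷ as ++ bs → y ∈ first ∷ x ∷ xs
      ∈-∷-map f (here eq) = here eq
      ∈-∷-map f (there y∈) = there (f y∈)
      m-max′ : ∀ {y} → y ∈ first ∷ x ∷ xs → c y ≤ c m
      m-max′ (here refl) = first-min m
      m-max′ (there y∈) = m-max y∈
      ΣL≡ : ΣL (first ∷ as ++ bs) + L m ≡ ΣL (first ∷ x ∷ xs)
      ΣL≡ = begin
        L first + ΣL (as ++ bs) + L m   ≡⟨ +-assoc (L first) _ _ ⟩
        L first + (ΣL (as ++ bs) + L m) ≡⟨ cong (L first +_) (+-comm (ΣL (as ++ bs)) _) ⟩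
        L first + (L m + ΣL (as ++ bs)) ≡⟨ cong (L first +_) (ΣL-remove as m bs) ⟨
        L first + ΣL (as ++ m ∷ bs)     ≡⟨ cong (λ zs → L first + ΣL zs) xs≡ ⟨
        ΣL (first ∷ x ∷ xs)             ∎
        where open ≡-Reasoning
      extend : Last k (as ++ bs) → Last (suc k) (x ∷ xs)
      extend (t , t∈ , _ , _ , ih) = m , there m∈ , m-max′ , (λ { refl → ⊥-elim (first∉ m∈) }) , ineq
        where
          ct≤cm : c t ≤ c m
          ct≤cm = m-max′ (∈-∷-map rest⊆ t∈)
          m≢t : m ≢ t
          m≢t refl = m∉first∷rest t∈
          ineq : suc k * n + L m + L first ≤ c m + 2 * ΣL (first ∷ x ∷ xs) + suc k * K
          ineq = subst₂ (λ a s → suc k * n + L m + L first ≤ a + 2 * s + suc k * K)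
                   (m+[n∸m]≡n ct≤cm) ΣL≡
                   (GapArithmetic.gap-step n k (L m) (L t) (L first) K (c t) (c m ∸ c t) (ΣL (first ∷ as ++ bs))
                      (subst (λ d → n ≤ L m + L t + K + d) (m≤n⇒∣n-m∣≡n∸m ct≤cm) (gap m t m≢t)) ih)

  ∃last-all : Σ V λ t → (t ≡ first → n ≡ 0) × n * n + L t + L first ≤ c t + 2 * ΣL (L.allFin (suc n)) + n * K
  ∃last-all with ∈-∃++ (∈-allFin first)
  ... | as , bs , all≡ = conclude (∃last n (as ++ bs) length-others (first∉others ∷ distinct-remove as dAll))
    where
      dAll : Distinct (as ++ first ∷ bs)
      dAll = subst Distinct all≡ (Unique⇒Distinct (Unique.allFin⁺ (suc n)))
      length-others : length (as ++ bs) ≡ n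
      length-others = suc-injective (trans (sym (length-remove as)) (trans (cong length (sym all≡)) (length-tabulate id)))
      first∉others : first ∉ as ++ bs
      first∉others first∈ with ∈-++⁻ as first∈
      ... | inj₁ first∈as = distinct-++-disjoint as dAll first∈as (here refl)
      ... | inj₂ first∈bs = distinct-head (distinct-++ʳ as dAll) first∈bs
      conclude : Last n (as ++ bs) → Σ V λ t → (t ≡ first → n ≡ 0) ×
                   n * n + L t + L first ≤ c t + 2 * ΣL (L.allFin (suc n)) + n * K
      conclude (t , _ , _ , t≡first⇒ , ineq) =
        t , (λ t≡first → trans (sym length-others) (cong length (t≡first⇒ t≡first))) ,
        subst (λ s → n * n + L t + L first ≤ c t + 2 * s + n * K)
              (trans (sym (ΣL-remove as first bs)) (cong ΣL (sym all≡))) ineq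

private
  rearrange : ∀ n ω ξ ct L Lt Lb → 1 ≤ ω → ω ≤ suc n → ξ ≤ Lt + Lb →
              n * n + Lt + Lb ≤ ct + 2 * L + n * (ω ∸ 1) → n * (suc n ∸ ω) + ξ ≤ ct + 2 * L
  rearrange n (suc ω) ξ ct L Lt Lb _ (s≤s ω≤n) ξ≤ ineq = begin
    n * (n ∸ ω) + ξ                   ≤⟨ +-monoʳ-≤ (n * (n ∸ ω)) ξ≤ ⟩
    n * (n ∸ ω) + (Lt + Lb)           ≤⟨ +-cancelʳ-≤ (n * ω) _ _ (subst (_≤ ct + 2 * L + n * ω) n*n≡ ineq) ⟩
    ct + 2 * L                        ∎
    where
      open ≤-Reasoning
      open +-*-Solver
      n*n≡ : n * n + Lt + Lb ≡ n * (n ∸ ω) + (Lt + Lb) + n * ω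
      n*n≡ = begin-equality
        n * n + Lt + Lb                       ≡⟨ cong (λ m → n * m + Lt + Lb) (m+[n∸m]≡n ω≤n) ⟨
        n * (ω + (n ∸ ω)) + Lt + Lb           ≡⟨ solve 5 (λ n ω r Lt Lb → n :* (ω :+ r) :+ Lt :+ Lb
                                                              := n :* r :+ (Lt :+ Lb) :+ n :* ω)
                                                   refl n ω (n ∸ ω) Lt Lb ⟩
        n * (n ∸ ω) + (Lt + Lb) + n * ω       ∎

theorem1 : (n : ℕ) → (G : Graph (suc n)) → IsBlockGraph G →
    (D : Fin (suc n) → Fin (suc n) → ℕ) → IsDetourDistance G D →
    (ξ : ℕ) → IsXi G D ξ →
    (c : Fin (suc n) → ℕ) → IsHamiltonianColoring D c →
    ∃ λ v → n * (suc n ∸ omega D) + ξ ≤ c v + 2 * totalLevel D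
theorem1 n G blockGraph D isD ξ isXi c hamiltonian =
  let t , t≡first⇒n≡0 , ineq = ∃last-all in
  t , rearrange n (omega D) ξ (c t) (totalLevel D) (level D t) (level D first) 1≤omega (SP.∣p∣≤n (centerSet D))
        (ξ≤level+level isXi t first t≡first⇒n≡0) ineq
  where
    open BlockGraphLevels G blockGraph D isD
    open Levels D using (1≤omega)
    gap : ∀ u v → u ≢ v → n ≤ level D u + level D v + (omega D ∸ 1) + ∣ c u - c v ∣
    gap u v u≢v = ≤-trans (hamiltonian u v u≢v) (+-monoˡ-≤ _ (D≤level+level+ω∸1 u v))
    open ColorGaps c (level D) (omega D ∸ 1) gap using (first; ∃last-all)
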